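{- Let $K$ be a finite field of characteristic $p$ and order $q$, and let $s$ be a positive integer with $\gcd(s,q-1)=1$. Then $|W|=q$ and $W\,\overline{W}=q^2[1]$ in $L[K^\times]$.
   Context: $\zeta=\exp(2\pi i/p)$, $\psi(x)=\zeta^{\mathrm{Tr}(x)}$ with $\mathrm{Tr}\colon K\to\mathbb{F}_p$ the absolute trace, $W_u=\sum_{x\in K}\psi(x^s-ux)$. $L=\mathbb{Q}(\zeta,\xi)$ with $\xi=\exp(2\pi i/(q-1))$, and $L[K^\times]$ is the group algebra of $K^\times$ over $L$. $W=\sum_{u\in K^\times}W_u[u]$. For $S=\sum S_u[u]$: $|S|=\sum_u S_u$ and $\overline{S}=\sum_u\overline{S_u}[u^{ -1}]$. -}

module Defs where

open import Level using (0ℓ)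
open import Data.Nat as ℕ using (ℕ; zero; suc; NonZero)
open import Data.Nat.DivMod using (_mod_)
open import Data.Fin using (Fin; toℕ)
open import Data.Fin.Base using () renaming (zero to fzero)
open import Data.Integer as ℤ using (ℤ)
open import Data.List using (List; []; _∷_; foldr; map; filter; length; allFin)
open import Data.List.Membership.Propositional using (_∈_)
open import Data.List.Relation.Unary.Unique.Propositional using (Unique)
open import Data.Product using (Σ; ∃; _×_)
open import Relation.Nullary using (¬_; Dec; yes; no)
open import Relation.Nullary.Decidable using (¬?)
open import Relation.Binary.PropositionalEquality using (_≡_)
open import Algebra.Structures using (IsCommutativeRing)

record FiniteField : Set₁ where
  field
    Carrier : Set
    _+_ _*_ : Carrier → Carrier → Carrier
    -_      : Carrier → Carrier
    0# 1#   : Carrier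
    isCommutativeRing : IsCommutativeRing _≡_ _+_ _*_ -_ 0# 1#
    _⁻¹     : Carrier → Carrier
    inverseʳ : ∀ x → ¬ (x ≡ 0#) → x * (x ⁻¹) ≡ 1#
    0≢1     : ¬ (0# ≡ 1#)
    _≟_     : (x y : Carrier) → Dec (x ≡ y)
    elements : List Carrier
    complete : ∀ x → x ∈ elements
    unique   : Unique elements

  infixl 7 _*_
  infixl 6 _+_ _-_

  _-_ : Carrier → Carrier → Carrier
  x - y = x + (- y)

  order : ℕ
  order = length elements

  units : List Carrier
  units = filter (λ x → ¬? (x ≟ 0#)) elements

  _^_ : Carrier → ℕ → Carrier
  x ^ zero  = 1#
  x ^ suc n = x * (x ^ n)

  ι : ℕ → Carrier
  ι zero    = 0#
  ι (suc n) = 1# + ι n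

  -- absolute trace  Tr(x) = Σ_{i<n} x^(p^i), where q = p^n
  trace : (p n : ℕ) → Carrier → Carrier
  trace p zero    x = 0#
  trace p (suc n) x = (x ^ (p ℕ.^ n)) + trace p n x

  -- identification of the prime field {k·1} with F_p = Fin p:
  -- the first k : Fin p with k·1 = y (default 0 if none exists).
  primeFieldIndex : (p : ℕ) .{{_ : NonZero p}} → Carrier → Fin p
  primeFieldIndex p y = search (allFin p)
    where
      search : List (Fin p) → Fin p
      search []       = 0 mod p
      search (k ∷ ks) with ι (toℕ k) ≟ y
      ... | yes _ = k
      ... | no  _ = search ks

-- The ring of cyclotomic integers ℤ[ζ_p] for p prime, ζ = exp(2πi/p).
-- An element Σ_k a_k ζ^k is represented by its coefficient function
-- a : Fin p → ℤ (i.e. an element of ℤ[C_p] = ℤ[x]/(x^p - 1)).  Since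
-- Φ_p = 1 + x + ... + x^(p-1), two representatives denote the same
-- complex number iff they differ by a constant function.

module Cyclotomic (p : ℕ) .{{_ : NonZero p}} where

  ℤζ : Set
  ℤζ = Fin p → ℤ

  _≈_ : ℤζ → ℤζ → Set
  a ≈ b = ∃ λ (c : ℤ) → ∀ k → a k ≡ b k ℤ.+ c

  _⊕_ : Fin p → Fin p → Fin p
  i ⊕ j = (toℕ i ℕ.+ toℕ j) mod p

  ⊖_ : Fin p → Fin p
  ⊖ i = (p ℕ.∸ toℕ i) mod p

  zeroζ : ℤζ
  zeroζ _ = ℤ.0ℤ

  fromℤ : ℤ → ℤζ
  fromℤ n k with toℕ k
  ... | zero  = n
  ... | suc _ = ℤ.0ℤ

  fromℕ : ℕ → ℤζ
  fromℕ n = fromℤ (ℤ.+ n)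

  ζ^ : Fin p → ℤζ
  ζ^ k = λ j → fromℤ (ℤ.+ 1) (j ⊕ (⊖ k))

  _+ζ_ : ℤζ → ℤζ → ℤζ
  (a +ζ b) k = a k ℤ.+ b k

  sumℤ : List ℤ → ℤ
  sumℤ = foldr ℤ._+_ ℤ.0ℤ

  _*ζ_ : ℤζ → ℤζ → ℤζ
  (a *ζ b) k = sumℤ (map (λ i → a i ℤ.* b (k ⊕ (⊖ i))) (allFin p))

  -- complex conjugation: ζ ↦ ζ^(-1)
  conj : ℤζ → ℤζ
  conj a k = a (⊖ k)

  sumζ : List ℤζ → ℤζ
  sumζ = foldr _+ζ_ zeroζ

module Weil (K : FiniteField) (p : ℕ) .{{_ : NonZero p}} (n s : ℕ) where
  open FiniteField K
  open Cyclotomic p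

  ψ : Carrier → ℤζ
  ψ x = ζ^ (primeFieldIndex p (trace p n x))

  Wcoef : Carrier → ℤζ
  Wcoef u = sumζ (map (λ x → ψ ((x ^ s) - u * x)) elements)

  -- Elements of the group algebra ℤ[ζ][K^×] are represented by their
  -- coefficient functions (only values at nonzero arguments matter).
  GA : Set
  GA = Carrier → ℤζ

  W : GA
  W = Wcoef

  ∣_∣ : GA → ℤζ
  ∣ S ∣ = sumζ (map S units)

  -- S̄ = Σ_u conj(S_u) [u⁻¹], i.e. (S̄)_w = conj(S_{w⁻¹})
  bar : GA → GA
  bar S w = conj (S (w ⁻¹))

  _·_ : GA → GA → GA
  (S · T) w = sumζ (map (λ u → S u *ζ T ((u ⁻¹) * w)) units)

  _[1] : ℤζ → GA
  (c [1]) w with w ≟ 1#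
  ... | yes _ = c
  ... | no  _ = zeroζ

  _≈GA_ : GA → GA → Set
  S ≈GA T = ∀ w → ¬ (w ≡ 0#) → S w ≈ T w

-- The additive character ψ = ζ ^ Tr is a homomorphism from (K, +) to the p-th roots of
-- unity, and it is nontrivial because the trace is a polynomial function of degree q / p,
-- which cannot vanish on all of K. Hence Σₓ ψ (a + c x) vanishes in ℤ[ζ] whenever c ≠ 0,
-- while for c = 0 it equals q ψ a. Since gcd (s, q - 1) = 1, x ↦ x ^ s permutes K.
-- Summing W over u ≠ 0 and exchanging sums gives |W| = q - Σₓ ψ (x ^ s) = q - Σₓ ψ x = q.
-- Expanding (W W̄)_w as a sum over x, y and u, the sum over u forces x = w⁻¹ y and leaves
-- q Σ_y ψ ((w⁻ˢ - 1) y ^ s), which is q² for w = 1 and vanishes otherwise.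
module Submission where

open import Defs
open import Level using (0ℓ)
open import Algebra.Bundles using (CommutativeMonoid; Semiring; CommutativeRing)
open import Algebra.Structures using (IsCommutativeRing)
import Algebra.Construct.Pointwise as Pointwise
import Algebra.Properties.CommutativeSemiring.Binomial
import Algebra.Solver.Ring.AlmostCommutativeRing as ACR
open import Data.Empty using (⊥-elim)
open import Data.Fin as Fin using (Fin; toℕ; fromℕ<)
import Data.Fin.Properties as Fin
open import Data.Integer as ℤ using (ℤ; -[1+_])
import Data.Integer.Properties as ℤ
open import Data.Integer.Tactic.RingSolver using (solve-∀)
open import Data.List using (List; []; _∷_; foldr; map; length; allFin)
open import Data.List.Properties using (map-∘; length-map; length-tabulate)
open import Data.List.Membership.Propositional using (_∈_)
open import Data.List.Membership.Propositional.Properties using (∈-map⁺; ∈-map⁻; ∈-filter⁺; ∈-filter⁻; ∈-allFin)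
open import Data.List.Membership.Propositional.Properties.WithK using (unique∧set⇒bag)
open import Data.List.Relation.Binary.BagAndSetEquality using (∼bag⇒↭)
open import Data.List.Relation.Binary.Permutation.Propositional using (_↭_; ↭⇒↭ₛ′)
import Data.List.Relation.Binary.Permutation.Propositional.Properties as ↭
open import Data.List.Relation.Binary.Permutation.Setoid.Properties using (foldr-commMonoid)
open import Data.List.Relation.Unary.All as All using (All; []; _∷_)
open import Data.List.Relation.Unary.All.Properties using (¬All⇒Any¬)
open import Data.List.Relation.Unary.Any using (here; there; satisfied)
open import Data.List.Relation.Unary.Unique.Propositional using (Unique; []; _∷_)
import Data.List.Relation.Unary.Unique.Propositional.Properties as Unique
open import Data.Maybe using (Maybe; just; nothing)
open import Data.Nat as ℕ using (ℕ; zero; suc; _≤_; _<_; z≤n; s≤s; _!; _∸_; pred; NonZero)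
import Data.Nat.Properties as ℕ
open import Data.Nat.Combinatorics using (_C_; nCk≡n!/k![n-k]!; k![n∸k]!∣n!; nCn≡1)
open import Data.Nat.Coprimality using (Coprime; coprime-Bézout)
open import Data.Nat.Divisibility using (_∣_; divides; ∣⇒≤)
open import Data.Nat.DivMod using (_mod_; _%_; _/_; m≡m%n+[m/n]*n; m%n<n; m*[n/m]≡n)
open import Data.Nat.GCD using (gcd; GCD; gcd-GCD; module Bézout)
open import Data.Nat.Primality using (Prime; euclidsLemma; prime⇒nonTrivial; prime⇒irreducible)
open import Data.Product using (Σ; ∃; _×_; _,_; proj₁; proj₂)
open import Data.Sign as Sign using (Sign)
open import Data.Sum using (inj₁; inj₂)
open import Function using (_∘_; _∘′_; id; flip; _⇔_; mk⇔)
open import Relation.Nullary using (¬_; yes; no; ¬?)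
open import Relation.Binary.Definitions using (tri<; tri≈; tri>)
open import Relation.Binary.PropositionalEquality as ≡
  using (_≡_; _≢_; refl; sym; trans; cong; cong₂; subst; module ≡-Reasoning)
import Relation.Binary.Reasoning.Setoid

module ListSum {c ℓ} (M : CommutativeMonoid c ℓ) where
  open CommutativeMonoid M
    renaming (refl to ≈-refl; sym to ≈-sym; trans to ≈-trans)
  open import Algebra.Properties.CommutativeSemigroup commutativeSemigroup using (interchange)
  open import Relation.Binary.Reasoning.Setoid setoid

  private variable A B : Set

  sumOver : (A → Carrier) → List A → Carrier
  sumOver F xs = foldr _∙_ ε (map F xs)

  sumOver-cong : ∀ {F G : A → Carrier} xs →
                 (∀ {x} → x ∈ xs → F x ≈ G x) → sumOver F xs ≈ sumOver G xs
  sumOver-cong []       F≈G = ≈-refl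
  sumOver-cong (x ∷ xs) F≈G = ∙-cong (F≈G (here refl)) (sumOver-cong xs (F≈G ∘ there))

  sumOver-ε : ∀ {F : A → Carrier} xs → (∀ {x} → x ∈ xs → F x ≈ ε) → sumOver F xs ≈ ε
  sumOver-ε []       F≈ε = ≈-refl
  sumOver-ε (x ∷ xs) F≈ε =
    ≈-trans (∙-cong (F≈ε (here refl)) (sumOver-ε xs (F≈ε ∘ there))) (identityˡ ε)

  sumOver-∙ : ∀ (F G : A → Carrier) xs →
              sumOver (λ x → F x ∙ G x) xs ≈ sumOver F xs ∙ sumOver G xs
  sumOver-∙ F G []       = ≈-sym (identityˡ ε)
  sumOver-∙ F G (x ∷ xs) = begin
    (F x ∙ G x) ∙ sumOver (λ x → F x ∙ G x) xs ≈⟨ ∙-congˡ (sumOver-∙ F G xs) ⟩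
    (F x ∙ G x) ∙ (sumOver F xs ∙ sumOver G xs) ≈⟨ interchange (F x) (G x) _ _ ⟩
    (F x ∙ sumOver F xs) ∙ (G x ∙ sumOver G xs) ∎

  sumOver-swap : ∀ (F : A → B → Carrier) xs ys →
                 sumOver (λ x → sumOver (F x) ys) xs ≈ sumOver (λ y → sumOver (λ x → F x y) xs) ys
  sumOver-swap F []       ys = ≈-sym (sumOver-ε ys (λ _ → ≈-refl))
  sumOver-swap F (x ∷ xs) ys = begin
    sumOver (F x) ys ∙ sumOver (λ x → sumOver (F x) ys) xs
      ≈⟨ ∙-congˡ (sumOver-swap F xs ys) ⟩
    sumOver (F x) ys ∙ sumOver (λ y → sumOver (λ x → F x y) xs) ys
      ≈⟨ sumOver-∙ (F x) (λ y → sumOver (λ x → F x y) xs) ys ⟨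
    sumOver (λ y → F x y ∙ sumOver (λ x → F x y) xs) ys ∎

  sumOver-↭ : ∀ (F : A → Carrier) {xs ys} → xs ↭ ys → sumOver F xs ≈ sumOver F ys
  sumOver-↭ F p = foldr-commMonoid setoid isCommutativeMonoid (↭⇒↭ₛ′ isEquivalence (↭.map⁺ F p))

  sumOver-map : ∀ (F : B → Carrier) (f : A → B) xs →
                sumOver F (map f xs) ≡ sumOver (F ∘ f) xs
  sumOver-map F f xs = cong (foldr _∙_ ε) (≡.sym (map-∘ xs))

  sumOver-δ : ∀ {F : A → Carrier} {a} xs → Unique xs → a ∈ xs →
              (∀ {x} → x ∈ xs → x ≢ a → F x ≈ ε) → sumOver F xs ≈ F a
  sumOver-δ {F = F} (x ∷ xs) (x∉xs ∷ u) (here refl) F≈ε = begin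
    F x ∙ sumOver F xs ≈⟨ ∙-congˡ (sumOver-ε xs (λ y∈xs → F≈ε (there y∈xs) (x≢y y∈xs))) ⟩
    F x ∙ ε            ≈⟨ identityʳ (F x) ⟩
    F x                ∎
    where
    x≢y : ∀ {y} → y ∈ xs → y ≢ x
    x≢y y∈xs y≡x = All.lookup x∉xs y∈xs (≡.sym y≡x)
  sumOver-δ {F = F} {a} (x ∷ xs) (x∉xs ∷ u) (there a∈xs) F≈ε = begin
    F x ∙ sumOver F xs ≈⟨ ∙-cong (F≈ε (here refl) x≢a) (sumOver-δ xs u a∈xs (F≈ε ∘ there)) ⟩
    ε ∙ F a            ≈⟨ identityˡ (F a) ⟩
    F a                ∎
    where
    x≢a : x ≢ a
    x≢a = All.lookup x∉xs a∈xs

module ListSum-* {c ℓ} (R : Semiring c ℓ) where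
  open Semiring R renaming (refl to ≈-refl; trans to ≈-trans)
  open ListSum +-commutativeMonoid public

  module _ {A : Set} where

    sumOver-*ˡ : ∀ (F : A → Carrier) a xs → a * sumOver F xs ≈ sumOver (λ x → a * F x) xs
    sumOver-*ˡ F a []       = zeroʳ a
    sumOver-*ˡ F a (x ∷ xs) = ≈-trans (distribˡ a (F x) _) (+-congˡ (sumOver-*ˡ F a xs))

    sumOver-*ʳ : ∀ (F : A → Carrier) a xs → sumOver F xs * a ≈ sumOver (λ x → F x * a) xs
    sumOver-*ʳ F a []       = zeroˡ a
    sumOver-*ʳ F a (x ∷ xs) = ≈-trans (distribʳ a (F x) _) (+-congˡ (sumOver-*ʳ F a xs))

module _ {A : Set} where

  unique-same-members⇒↭ : ∀ {xs ys : List A} → Unique xs → Unique ys →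
                          (∀ {x} → x ∈ xs ⇔ x ∈ ys) → xs ↭ ys
  unique-same-members⇒↭ ux uy xs≈ys = ∼bag⇒↭ (unique∧set⇒bag ux uy xs≈ys)

  map-inverse-↭ : ∀ (f g : A → A) {xs} → (∀ x → g (f x) ≡ x) → (∀ x → f (g x) ≡ x) →
                  Unique xs → (∀ {x} → x ∈ xs → f x ∈ xs) → (∀ {x} → x ∈ xs → g x ∈ xs) →
                  map f xs ↭ xs
  map-inverse-↭ f g {xs} g∘f f∘g u f∈ g∈ =
    unique-same-members⇒↭ (Unique.map⁺ f-injective u) u (mk⇔ to from)
    where
    f-injective : ∀ {x y} → f x ≡ f y → x ≡ y
    f-injective {x} {y} fx≡fy = ≡.trans (≡.sym (g∘f x)) (≡.trans (cong g fx≡fy) (g∘f y))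
    to : ∀ {y} → y ∈ map f xs → y ∈ xs
    to y∈ with ∈-map⁻ f y∈
    ... | x , x∈ , refl = f∈ x∈
    from : ∀ {y} → y ∈ xs → y ∈ map f xs
    from {y} y∈ = subst (_∈ map f xs) (f∘g y) (∈-map⁺ f (g∈ y∈))

module IntegerCoefficients (K : FiniteField) where
  open FiniteField K public
  open IsCommutativeRing isCommutativeRing public
    using ( +-assoc; +-comm; +-identityˡ; +-identityʳ; -‿inverseʳ
          ; *-assoc; *-comm; *-identityˡ; *-identityʳ; distribˡ; distribʳ; zeroˡ; zeroʳ)

  commutativeRing : CommutativeRing 0ℓ 0ℓ
  commutativeRing = record { isCommutativeRing = isCommutativeRing }

  open import Algebra.Properties.Ring (CommutativeRing.ring commutativeRing) public
    using (-‿involutive; -‿distribˡ-*; -‿distribʳ-*; -0#≈0#; -‿+-comm)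
  open CommutativeRing commutativeRing using (+-commutativeSemigroup; *-commutativeSemigroup)
  open import Algebra.Properties.CommutativeSemigroup +-commutativeSemigroup public
    using () renaming (interchange to +-interchange)
  open import Algebra.Properties.CommutativeSemigroup *-commutativeSemigroup public
    using () renaming (interchange to *-interchange)
  open ≡-Reasoning

  ι-+ : ∀ m n → ι (m ℕ.+ n) ≡ ι m + ι n
  ι-+ zero    n = sym (+-identityˡ _)
  ι-+ (suc m) n = trans (cong (1# +_) (ι-+ m n)) (sym (+-assoc _ _ _))

  ι-* : ∀ m n → ι (m ℕ.* n) ≡ ι m * ι n
  ι-* zero    n = sym (zeroˡ _)
  ι-* (suc m) n = begin
    ι (n ℕ.+ m ℕ.* n)    ≡⟨ ι-+ n (m ℕ.* n) ⟩
    ι n + ι (m ℕ.* n)    ≡⟨ cong₂ _+_ (sym (*-identityˡ _)) (ι-* m n) ⟩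
    1# * ι n + ι m * ι n ≡⟨ distribʳ _ _ _ ⟨
    (1# + ι m) * ι n     ∎

  ⟦_⟧ : ℤ → Carrier
  ⟦ ℤ.+ n ⟧     = ι n
  ⟦ -[1+ n ] ⟧ = - ι (suc n)

  ⟦⊖⟧ : ∀ m n → ⟦ m ℤ.⊖ n ⟧ ≡ ι m - ι n
  ⟦⊖⟧ m       zero    = begin
    ⟦ m ℤ.⊖ 0 ⟧  ≡⟨ cong ⟦_⟧ (ℤ.⊖-≥ {m} ℕ.z≤n) ⟩
    ι m          ≡⟨ +-identityʳ _ ⟨
    ι m + 0#     ≡⟨ cong (ι m +_) -0#≈0# ⟨
    ι m - 0#     ∎
  ⟦⊖⟧ zero    (suc n) = sym (+-identityˡ _)
  ⟦⊖⟧ (suc m) (suc n) = begin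
    ⟦ suc m ℤ.⊖ suc n ⟧      ≡⟨ cong ⟦_⟧ (ℤ.[1+m]⊖[1+n]≡m⊖n m n) ⟩
    ⟦ m ℤ.⊖ n ⟧              ≡⟨ ⟦⊖⟧ m n ⟩
    ι m - ι n                ≡⟨ cong (_- ι n) (+-identityˡ _) ⟨
    0# + ι m - ι n           ≡⟨ cong (λ z → z + ι m - ι n) (-‿inverseʳ 1#) ⟨
    1# - 1# + ι m - ι n      ≡⟨ shuffle 1# (ι m) (ι n) ⟩
    (1# + ι m) - (1# + ι n)  ∎
    where
    shuffle : ∀ a b c → a - a + b - c ≡ (a + b) - (a + c)
    shuffle a b c = begin
      a + - a + b + - c      ≡⟨ cong (_+ - c) (+-assoc a (- a) b) ⟩
      a + (- a + b) + - c    ≡⟨ cong (λ z → a + z + - c) (+-comm (- a) b) ⟩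
      a + (b + - a) + - c    ≡⟨ cong (_+ - c) (+-assoc a b (- a)) ⟨
      a + b + - a + - c      ≡⟨ +-assoc (a + b) (- a) (- c) ⟩
      (a + b) + (- a + - c)  ≡⟨ cong ((a + b) +_) (-‿+-comm a c) ⟩
      (a + b) - (a + c)      ∎

  ⟦+⟧ : ∀ i j → ⟦ i ℤ.+ j ⟧ ≡ ⟦ i ⟧ + ⟦ j ⟧
  ⟦+⟧ (ℤ.+ m)    (ℤ.+ n)    = ι-+ m n
  ⟦+⟧ (ℤ.+ m)    -[1+ n ]   = ⟦⊖⟧ m (suc n)
  ⟦+⟧ -[1+ m ]   (ℤ.+ n)    = trans (⟦⊖⟧ n (suc m)) (+-comm _ _)
  ⟦+⟧ -[1+ m ]   -[1+ n ]   = begin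
    - ι (suc (suc (m ℕ.+ n)))      ≡⟨ cong (λ k → - ι (suc k)) (ℕ.+-suc m n) ⟨
    - ι (suc m ℕ.+ suc n)          ≡⟨ cong -_ (ι-+ (suc m) (suc n)) ⟩
    - (ι (suc m) + ι (suc n))      ≡⟨ -‿+-comm _ _ ⟨
    - ι (suc m) + - ι (suc n)      ∎

  ⟦-⟧ : ∀ i → ⟦ ℤ.- i ⟧ ≡ - ⟦ i ⟧
  ⟦-⟧ (ℤ.+ zero)  = sym -0#≈0#
  ⟦-⟧ (ℤ.+ suc n) = refl
  ⟦-⟧ -[1+ n ]    = sym (-‿involutive _)

  private
    signed : Sign → Carrier → Carrier
    signed Sign.+ x = x
    signed Sign.- x = - x

    ⟦◃⟧ : ∀ s n → ⟦ s ℤ.◃ n ⟧ ≡ signed s (ι n)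
    ⟦◃⟧ Sign.+ zero    = refl
    ⟦◃⟧ Sign.- zero    = sym -0#≈0#
    ⟦◃⟧ Sign.+ (suc n) = refl
    ⟦◃⟧ Sign.- (suc n) = refl

    ⟦⟧-signed : ∀ i → ⟦ i ⟧ ≡ signed (ℤ.sign i) (ι ℤ.∣ i ∣)
    ⟦⟧-signed (ℤ.+ n)  = refl
    ⟦⟧-signed -[1+ n ] = refl

    signed-* : ∀ s t x y → signed (s Sign.* t) (x * y) ≡ signed s x * signed t y
    signed-* Sign.+ Sign.+ x y = refl
    signed-* Sign.+ Sign.- x y = -‿distribʳ-* x y
    signed-* Sign.- Sign.+ x y = -‿distribˡ-* x y
    signed-* Sign.- Sign.- x y = begin
      x * y             ≡⟨ -‿involutive _ ⟨
      - - (x * y)       ≡⟨ cong -_ (-‿distribˡ-* x y) ⟩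
      - ((- x) * y)     ≡⟨ -‿distribʳ-* (- x) y ⟩
      (- x) * (- y)     ∎

  ⟦*⟧ : ∀ i j → ⟦ i ℤ.* j ⟧ ≡ ⟦ i ⟧ * ⟦ j ⟧
  ⟦*⟧ i j = begin
    ⟦ i ℤ.* j ⟧                                    ≡⟨ ⟦◃⟧ (s Sign.* t) (ℤ.∣ i ∣ ℕ.* ℤ.∣ j ∣) ⟩
    signed (s Sign.* t) (ι (ℤ.∣ i ∣ ℕ.* ℤ.∣ j ∣))  ≡⟨ cong (signed (s Sign.* t)) (ι-* ℤ.∣ i ∣ ℤ.∣ j ∣) ⟩
    signed (s Sign.* t) (ι ℤ.∣ i ∣ * ι ℤ.∣ j ∣)    ≡⟨ signed-* s t _ _ ⟩
    signed s (ι ℤ.∣ i ∣) * signed t (ι ℤ.∣ j ∣)    ≡⟨ cong₂ _*_ (⟦⟧-signed i) (⟦⟧-signed j) ⟨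
    ⟦ i ⟧ * ⟦ j ⟧                                  ∎
    where
    s t : Sign
    s = ℤ.sign i
    t = ℤ.sign j

  private
    almostCommutativeRing : ACR.AlmostCommutativeRing 0ℓ 0ℓ
    almostCommutativeRing = ACR.fromCommutativeRing commutativeRing

    ℤ⟶K : ℤ.+-*-rawRing ACR.-Raw-AlmostCommutative⟶ almostCommutativeRing
    ℤ⟶K = record
      { ⟦_⟧ = ⟦_⟧ ; +-homo = ⟦+⟧ ; *-homo = ⟦*⟧ ; -‿homo = ⟦-⟧
      ; 0-homo = refl ; 1-homo = +-identityʳ 1# }

    ⟦⟧-≟ : ∀ i j → Maybe (⟦ i ⟧ ≡ ⟦ j ⟧)
    ⟦⟧-≟ i j with i ℤ.≟ j
    ... | yes i≡j = just (cong ⟦_⟧ i≡j)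
    ... | no  _   = nothing

  open import Algebra.Solver.Ring ℤ.+-*-rawRing almostCommutativeRing ℤ⟶K ⟦⟧-≟ public
    using (solve; _:=_; _:+_; _:*_; _:-_; :-_)

module Field (K : FiniteField) where
  open IntegerCoefficients K public
  open ≡-Reasoning

  1≢0 : 1# ≢ 0#
  1≢0 = 0≢1 ∘ sym

  inverseˡ : ∀ {x} → x ≢ 0# → x ⁻¹ * x ≡ 1#
  inverseˡ {x} x≢0 = trans (*-comm _ _) (inverseʳ x x≢0)

  x⁻¹*[x*y]≡y : ∀ {x} → x ≢ 0# → ∀ y → x ⁻¹ * (x * y) ≡ y
  x⁻¹*[x*y]≡y {x} x≢0 y = trans (sym (*-assoc _ _ _)) (trans (cong (_* y) (inverseˡ x≢0)) (*-identityˡ y))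

  x*[x⁻¹*y]≡y : ∀ {x} → x ≢ 0# → ∀ y → x * (x ⁻¹ * y) ≡ y
  x*[x⁻¹*y]≡y {x} x≢0 y = trans (sym (*-assoc _ _ _)) (trans (cong (_* y) (inverseʳ x x≢0)) (*-identityˡ y))

  *-cancelˡ : ∀ {c} x y → c ≢ 0# → c * x ≡ c * y → x ≡ y
  *-cancelˡ {c} x y c≢0 cx≡cy =
    trans (sym (x⁻¹*[x*y]≡y c≢0 x)) (trans (cong (c ⁻¹ *_) cx≡cy) (x⁻¹*[x*y]≡y c≢0 y))

  *-≢0 : ∀ {x y} → x ≢ 0# → y ≢ 0# → x * y ≢ 0#
  *-≢0 {x} {y} x≢0 y≢0 xy≡0 = y≢0 (*-cancelˡ y 0# x≢0 (trans xy≡0 (sym (zeroʳ x))))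

  ⁻¹-unique : ∀ {x y} → x * y ≡ 1# → y ≡ x ⁻¹
  ⁻¹-unique {x} {y} xy≡1 with x ≟ 0#
  ... | yes refl = ⊥-elim (0≢1 (trans (sym (zeroˡ y)) xy≡1))
  ... | no x≢0   = *-cancelˡ y (x ⁻¹) x≢0 (trans xy≡1 (sym (inverseʳ x x≢0)))

  ⁻¹-≢0 : ∀ {x} → x ≢ 0# → x ⁻¹ ≢ 0#
  ⁻¹-≢0 {x} x≢0 x⁻¹≡0 = 0≢1 (begin
    0#          ≡⟨ zeroʳ x ⟨
    x * 0#      ≡⟨ cong (x *_) x⁻¹≡0 ⟨
    x * x ⁻¹    ≡⟨ inverseʳ x x≢0 ⟩
    1#          ∎)

  ⁻¹-involutive : ∀ {x} → x ≢ 0# → (x ⁻¹) ⁻¹ ≡ x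
  ⁻¹-involutive x≢0 = sym (⁻¹-unique (inverseˡ x≢0))

  1⁻¹≡1 : 1# ⁻¹ ≡ 1#
  1⁻¹≡1 = sym (⁻¹-unique (*-identityˡ 1#))

  ⁻¹-distrib-* : ∀ {x y} → x ≢ 0# → y ≢ 0# → (x * y) ⁻¹ ≡ x ⁻¹ * y ⁻¹
  ⁻¹-distrib-* {x} {y} x≢0 y≢0 = sym (⁻¹-unique (begin
    (x * y) * (x ⁻¹ * y ⁻¹)  ≡⟨ *-interchange x y (x ⁻¹) (y ⁻¹) ⟩
    (x * x ⁻¹) * (y * y ⁻¹)  ≡⟨ cong₂ _*_ (inverseʳ x x≢0) (inverseʳ y y≢0) ⟩
    1# * 1#                  ≡⟨ *-identityˡ 1# ⟩
    1#                       ∎))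

  -x≡0⇒x≡0 : ∀ {x} → - x ≡ 0# → x ≡ 0#
  -x≡0⇒x≡0 {x} -x≡0 = trans (sym (-‿involutive x)) (trans (cong -_ -x≡0) -0#≈0#)

  x-y≡0⇒x≡y : ∀ {x y} → x - y ≡ 0# → x ≡ y
  x-y≡0⇒x≡y {x} {y} x-y≡0 = begin
    x              ≡⟨ solve 2 (λ x y → x := (x :- y) :+ y) refl x y ⟩
    (x - y) + y    ≡⟨ cong (_+ y) x-y≡0 ⟩
    0# + y         ≡⟨ +-identityˡ y ⟩
    y              ∎

  ^-distribˡ-+-* : ∀ x m n → x ^ (m ℕ.+ n) ≡ x ^ m * x ^ n
  ^-distribˡ-+-* x zero    n = sym (*-identityˡ _)
  ^-distribˡ-+-* x (suc m) n = trans (cong (x *_) (^-distribˡ-+-* x m n)) (sym (*-assoc _ _ _))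

  ^-distribʳ-* : ∀ x y n → (x * y) ^ n ≡ x ^ n * y ^ n
  ^-distribʳ-* x y zero    = sym (*-identityˡ 1#)
  ^-distribʳ-* x y (suc n) = trans (cong ((x * y) *_) (^-distribʳ-* x y n))
                             (*-interchange x y (x ^ n) (y ^ n))

  ^-*-assoc : ∀ x m n → (x ^ m) ^ n ≡ x ^ (m ℕ.* n)
  ^-*-assoc x m zero    = cong (x ^_) (sym (ℕ.*-zeroʳ m))
  ^-*-assoc x m (suc n) = begin
    x ^ m * (x ^ m) ^ n    ≡⟨ cong (x ^ m *_) (^-*-assoc x m n) ⟩
    x ^ m * x ^ (m ℕ.* n)  ≡⟨ ^-distribˡ-+-* x m (m ℕ.* n) ⟨
    x ^ (m ℕ.+ m ℕ.* n)    ≡⟨ cong (x ^_) (ℕ.*-suc m n) ⟨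
    x ^ (m ℕ.* suc n)      ∎

  1^n≡1 : ∀ n → 1# ^ n ≡ 1#
  1^n≡1 zero    = refl
  1^n≡1 (suc n) = trans (*-identityˡ _) (1^n≡1 n)

  ^-≢0 : ∀ {x} n → x ≢ 0# → x ^ n ≢ 0#
  ^-≢0 zero    x≢0 = 1≢0
  ^-≢0 (suc n) x≢0 = *-≢0 x≢0 (^-≢0 n x≢0)

  ⁻¹-^ : ∀ {x} n → x ≢ 0# → (x ⁻¹) ^ n ≡ (x ^ n) ⁻¹
  ⁻¹-^ {x} n x≢0 = ⁻¹-unique (begin
    x ^ n * (x ⁻¹) ^ n    ≡⟨ ^-distribʳ-* x (x ⁻¹) n ⟨
    (x * x ⁻¹) ^ n        ≡⟨ cong (_^ n) (inverseʳ x x≢0) ⟩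
    1# ^ n                ≡⟨ 1^n≡1 n ⟩
    1#                    ∎)

  units-unique : Unique units
  units-unique = Unique.filter⁺ (λ x → ¬? (x ≟ 0#)) unique

  ∈-units : ∀ {x} → x ≢ 0# → x ∈ units
  ∈-units {x} x≢0 = ∈-filter⁺ (λ x → ¬? (x ≟ 0#)) (complete x) x≢0

  units-≢0 : ∀ {x} → x ∈ units → x ≢ 0#
  units-≢0 x∈units = proj₂ (∈-filter⁻ (λ x → ¬? (x ≟ 0#)) {xs = elements} x∈units)

  elements↭0∷units : elements ↭ 0# ∷ units
  elements↭0∷units = unique-same-members⇒↭ unique (0∉units ∷ units-unique) (mk⇔ to λ _ → complete _)
    where
    0∉units : All (0# ≢_) units
    0∉units = All.tabulate λ u∈units 0≡u → units-≢0 u∈units (sym 0≡u)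
    to : ∀ {x} → x ∈ elements → x ∈ 0# ∷ units
    to {x} _ with x ≟ 0#
    ... | yes x≡0 = here x≡0
    ... | no  x≢0 = there (∈-units x≢0)

  order≡1+#units : order ≡ suc (length units)
  order≡1+#units = ↭.↭-length elements↭0∷units

  1<order : 1 < order
  1<order = subst (1 <_) (sym order≡1+#units) (s≤s (nonempty (∈-units 1≢0)))
    where
    nonempty : ∀ {x} {xs : List Carrier} → x ∈ xs → 1 ≤ length xs
    nonempty (here _)  = s≤s z≤n
    nonempty (there _) = s≤s z≤n

  open ListSum (CommutativeRing.*-commutativeMonoid commutativeRing)
    using () renaming (sumOver to productOver; sumOver-↭ to productOver-↭; sumOver-map to productOver-map)

  private
    productOver-scale : ∀ x (us : List Carrier) →
                        productOver (x *_) us ≡ x ^ length us * productOver id us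
    productOver-scale x []       = sym (*-identityˡ 1#)
    productOver-scale x (u ∷ us) = trans (cong ((x * u) *_) (productOver-scale x us))
                                   (*-interchange x u (x ^ length us) (productOver id us))

    productOver-≢0 : ∀ us → (∀ {u} → u ∈ us → u ≢ 0#) → productOver id us ≢ 0#
    productOver-≢0 []       _   = 1≢0
    productOver-≢0 (u ∷ us) us≢0 = *-≢0 (us≢0 (here refl)) (productOver-≢0 us (us≢0 ∘ there))

  -- Multiplication by x permutes the units, so x ^ #units ⋅ ∏ units = ∏ units.
  x^#units≡1 : ∀ {x} → x ≢ 0# → x ^ length units ≡ 1#
  x^#units≡1 {x} x≢0 = *-cancelˡ _ _ (productOver-≢0 units units-≢0) (begin
    P * x ^ length units              ≡⟨ *-comm _ _ ⟩
    x ^ length units * P              ≡⟨ productOver-scale x units ⟨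
    productOver (x *_) units          ≡⟨ productOver-map id (x *_) units ⟨
    productOver id (map (x *_) units) ≡⟨ productOver-↭ id x*-permutes ⟩
    P                                 ≡⟨ *-identityʳ P ⟨
    P * 1#                            ∎)
    where
    P : Carrier
    P = productOver id units
    x*-permutes : map (x *_) units ↭ units
    x*-permutes = map-inverse-↭ (x *_) (x ⁻¹ *_) (x⁻¹*[x*y]≡y x≢0) (x*[x⁻¹*y]≡y x≢0) units-unique
      (λ u∈ → ∈-units (*-≢0 x≢0 (units-≢0 u∈)))
      (λ u∈ → ∈-units (*-≢0 (⁻¹-≢0 x≢0) (units-≢0 u∈)))

  x^order≡x : ∀ x → x ^ order ≡ x
  x^order≡x x with x ≟ 0#
  ... | yes refl = trans (cong (0# ^_) order≡1+#units) (zeroˡ _)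
  ... | no  x≢0  = trans (cong (x ^_) order≡1+#units)
                         (trans (cong (x *_) (x^#units≡1 x≢0)) (*-identityʳ x))

  x^[k*#units]≡1 : ∀ {x} k → x ≢ 0# → x ^ (k ℕ.* length units) ≡ 1#
  x^[k*#units]≡1 {x} k x≢0 = begin
    x ^ (k ℕ.* length units)  ≡⟨ cong (x ^_) (ℕ.*-comm k (length units)) ⟩
    x ^ (length units ℕ.* k)  ≡⟨ ^-*-assoc x (length units) k ⟨
    (x ^ length units) ^ k    ≡⟨ cong (_^ k) (x^#units≡1 x≢0) ⟩
    1# ^ k                    ≡⟨ 1^n≡1 k ⟩
    1#                        ∎

  0^n≡0 : ∀ {n} → n ℕ.≥ 1 → 0# ^ n ≡ 0#
  0^n≡0 (ℕ.s≤s _) = zeroˡ _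

  module _ {s} (s≥1 : s ℕ.≥ 1) (coprime : gcd s (order ℕ.∸ 1) ≡ 1) where

    private
      gcd[s,#units]≡1 : GCD s (length units) 1
      gcd[s,#units]≡1 = subst (λ m → GCD s m 1) (cong (ℕ._∸ 1) order≡1+#units)
                          (subst (GCD s (order ℕ.∸ 1)) coprime (gcd-GCD s (order ℕ.∸ 1)))

    -- By Bézout a s ≡ ± 1 modulo #units for some a, so the s-th root is y ↦ y ^ a or
    -- y ↦ (y ^ a)⁻¹.
    s-th-root : Σ (Carrier → Carrier) λ root → (∀ x → root (x ^ s) ≡ x) × (∀ y → root y ^ s ≡ y)
    s-th-root with Bézout.identity gcd[s,#units]≡1
    ... | Bézout.+- a b 1+b#≡as = (_^ a) , root-^ , ^-root
      where
      x^as≡x : ∀ x → x ^ (a ℕ.* s) ≡ x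
      x^as≡x x with x ≟ 0#
      ... | yes refl = trans (cong (0# ^_) (sym 1+b#≡as)) (zeroˡ _)
      ... | no  x≢0  = trans (cong (x ^_) (sym 1+b#≡as))
                             (trans (cong (x *_) (x^[k*#units]≡1 b x≢0)) (*-identityʳ x))
      root-^ : ∀ x → (x ^ s) ^ a ≡ x
      root-^ x = trans (^-*-assoc x s a) (trans (cong (x ^_) (ℕ.*-comm s a)) (x^as≡x x))
      ^-root : ∀ y → (y ^ a) ^ s ≡ y
      ^-root y = trans (^-*-assoc y a s) (x^as≡x y)
    ... | Bézout.-+ a b 1+as≡b# = root , root-^ , ^-root
      where
      x^as≡x⁻¹ : ∀ {x} → x ≢ 0# → x ^ (a ℕ.* s) ≡ x ⁻¹
      x^as≡x⁻¹ {x} x≢0 = ⁻¹-unique (trans (cong (x ^_) 1+as≡b#) (x^[k*#units]≡1 b x≢0))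
      root : Carrier → Carrier
      root y with y ≟ 0#
      ... | yes _ = 0#
      ... | no  _ = (y ^ a) ⁻¹
      root-^ : ∀ x → root (x ^ s) ≡ x
      root-^ x with x ≟ 0# | (x ^ s) ≟ 0#
      ... | yes refl | yes _    = refl
      ... | yes refl | no  0^s≢0 = ⊥-elim (0^s≢0 (0^n≡0 s≥1))
      ... | no  x≢0  | yes x^s≡0 = ⊥-elim (^-≢0 s x≢0 x^s≡0)
      ... | no  x≢0  | no  _    = begin
        ((x ^ s) ^ a) ⁻¹  ≡⟨ cong _⁻¹ (^-*-assoc x s a) ⟩
        (x ^ (s ℕ.* a)) ⁻¹ ≡⟨ cong (λ k → (x ^ k) ⁻¹) (ℕ.*-comm s a) ⟩
        (x ^ (a ℕ.* s)) ⁻¹ ≡⟨ cong _⁻¹ (x^as≡x⁻¹ x≢0) ⟩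
        (x ⁻¹) ⁻¹         ≡⟨ ⁻¹-involutive x≢0 ⟩
        x                 ∎
      ^-root : ∀ y → root y ^ s ≡ y
      ^-root y with y ≟ 0#
      ... | yes refl = 0^n≡0 s≥1
      ... | no  y≢0  = begin
        ((y ^ a) ⁻¹) ^ s   ≡⟨ ⁻¹-^ s (^-≢0 a y≢0) ⟩
        ((y ^ a) ^ s) ⁻¹   ≡⟨ cong _⁻¹ (trans (^-*-assoc y a s) (x^as≡x⁻¹ y≢0)) ⟩
        (y ⁻¹) ⁻¹          ≡⟨ ⁻¹-involutive y≢0 ⟩
        y                  ∎

module PolynomialFunctions (K : FiniteField) where
  open Field K
  open ≡-Reasoning

  -- Polynomial functions are described through the factor theorem: f has degree ≤ d + 1
  -- when every f x - f a is (x - a) times a function of degree ≤ d.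
  Degree≤ : ℕ → (Carrier → Carrier) → Set
  Degree≤ zero    f = ∀ x y → f x ≡ f y
  Degree≤ (suc d) f = ∀ a → Σ (Carrier → Carrier) λ g → Degree≤ d g × (∀ x → f x ≡ f a + (x - a) * g x)

  Monic : ℕ → (Carrier → Carrier) → Set
  Monic zero    f = ∀ x → f x ≡ 1#
  Monic (suc d) f = ∀ a → Σ (Carrier → Carrier) λ g → Monic d g × (∀ x → f x ≡ f a + (x - a) * g x)

  Degree≤-const : ∀ d c → Degree≤ d (λ _ → c)
  Degree≤-const zero    c x y = refl
  Degree≤-const (suc d) c a   =
    (λ _ → 0#) , Degree≤-const d 0# , λ x → sym (trans (cong (c +_) (zeroʳ _)) (+-identityʳ c))

  private
    factors-+ : ∀ {fx fa gx hx ha kx t} → fx ≡ fa + t * gx → hx ≡ ha + t * kx →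
                fx + hx ≡ (fa + ha) + t * (gx + kx)
    factors-+ {fx} {fa} {gx} {hx} {ha} {kx} {t} fx≡ hx≡ = begin
      fx + hx                            ≡⟨ cong₂ _+_ fx≡ hx≡ ⟩
      (fa + t * gx) + (ha + t * kx)      ≡⟨ +-interchange fa (t * gx) ha (t * kx) ⟩
      (fa + ha) + (t * gx + t * kx)      ≡⟨ cong ((fa + ha) +_) (distribˡ t gx kx) ⟨
      (fa + ha) + t * (gx + kx)          ∎

  Degree≤-+ : ∀ d {f h} → Degree≤ d f → Degree≤ d h → Degree≤ d (λ x → f x + h x)
  Degree≤-+ zero    f≤ h≤ x y = cong₂ _+_ (f≤ x y) (h≤ x y)
  Degree≤-+ (suc d) f≤ h≤ a with f≤ a | h≤ a
  ... | g , g≤ , f≡ | k , k≤ , h≡ =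
    (λ x → g x + k x) , Degree≤-+ d g≤ k≤ , λ x → factors-+ (f≡ x) (h≡ x)

  Degree≤-scale : ∀ d c {f} → Degree≤ d f → Degree≤ d (λ x → c * f x)
  Degree≤-scale zero    c f≤ x y = cong (c *_) (f≤ x y)
  Degree≤-scale (suc d) c {f} f≤ a with f≤ a
  ... | g , g≤ , f≡ = (λ x → c * g x) , Degree≤-scale d c g≤ , λ x → begin
    c * f x                        ≡⟨ cong (c *_) (f≡ x) ⟩
    c * (f a + (x - a) * g x)      ≡⟨ solve 4 (λ c fa t g → c :* (fa :+ t :* g) := c :* fa :+ t :* (c :* g))
                                              refl c (f a) (x - a) (g x) ⟩
    c * f a + (x - a) * (c * g x)  ∎

  Degree≤-mono : ∀ {d e f} → d ≤ e → Degree≤ d f → Degree≤ e f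
  Degree≤-mono {zero} {zero}  z≤n f≤ = f≤
  Degree≤-mono {zero} {suc e} {f} z≤n f≤ a =
    (λ _ → 0#) , Degree≤-const e 0# ,
    λ x → sym (trans (cong (f a +_) (zeroʳ _)) (trans (+-identityʳ _) (f≤ a x)))
  Degree≤-mono {suc d} {suc e} (s≤s d≤e) f≤ a with f≤ a
  ... | g , g≤ , f≡ = g , Degree≤-mono d≤e g≤ , f≡

  Monic⇒Degree≤ : ∀ d {f} → Monic d f → Degree≤ d f
  Monic⇒Degree≤ zero    f-monic x y = trans (f-monic x) (sym (f-monic y))
  Monic⇒Degree≤ (suc d) f-monic a with f-monic a
  ... | g , g-monic , f≡ = g , Monic⇒Degree≤ d g-monic , f≡

  Monic-+ : ∀ {d e f h} → e < d → Monic d f → Degree≤ e h → Monic d (λ x → f x + h x)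
  Monic-+ {suc d} {zero} {f} {h} (s≤s z≤n) f-monic h≤ a with f-monic a
  ... | g , g-monic , f≡ = g , g-monic , λ x → begin
    f x + h x                    ≡⟨ cong₂ _+_ (f≡ x) (h≤ x a) ⟩
    (f a + (x - a) * g x) + h a  ≡⟨ solve 4 (λ fa t g ha → (fa :+ t :* g) :+ ha := (fa :+ ha) :+ t :* g)
                                            refl (f a) (x - a) (g x) (h a) ⟩
    (f a + h a) + (x - a) * g x  ∎
  Monic-+ {suc d} {suc e} (s≤s e<d) f-monic h≤ a with f-monic a | h≤ a
  ... | g , g-monic , f≡ | k , k≤ , h≡ =
    (λ x → g x + k x) , Monic-+ e<d g-monic k≤ , λ x → factors-+ (f≡ x) (h≡ x)

  Monic-^ : ∀ n → Monic n (_^ n)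
  Monic-^ zero    x = refl
  Monic-^ (suc n) a = quotient n , quotient-monic n , factor n
    where
    quotient : ℕ → Carrier → Carrier
    quotient zero    x = 1#
    quotient (suc m) x = x ^ suc m + a * quotient m x

    factor : ∀ m x → x ^ suc m ≡ a ^ suc m + (x - a) * quotient m x
    factor zero    x = solve 3 (λ x a o → x :* o := a :* o :+ (x :- a) :* o) refl x a 1#
    factor (suc m) x = begin
      x * x ^ suc m
        ≡⟨ solve 3 (λ x a X → x :* X := a :* X :+ (x :- a) :* X) refl x a (x ^ suc m) ⟩
      a * x ^ suc m + (x - a) * x ^ suc m
        ≡⟨ cong (λ z → a * z + (x - a) * x ^ suc m) (factor m x) ⟩
      a * (a ^ suc m + (x - a) * quotient m x) + (x - a) * x ^ suc m
        ≡⟨ solve 5 (λ a A t q X → a :* (A :+ t :* q) :+ t :* X := a :* A :+ t :* (X :+ a :* q))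
                 refl a (a ^ suc m) (x - a) (quotient m x) (x ^ suc m) ⟩
      a * a ^ suc m + (x - a) * (x ^ suc m + a * quotient m x) ∎

    quotient-monic : ∀ m → Monic m (quotient m)
    quotient-monic zero    x = refl
    quotient-monic (suc m) =
      Monic-+ ℕ.≤-refl (Monic-^ (suc m)) (Degree≤-scale m a (Monic⇒Degree≤ m (quotient-monic m)))

  roots-bound : ∀ d {f} → Monic d f → (xs : List Carrier) → Unique xs →
                All (λ x → f x ≡ 0#) xs → length xs ≤ d
  roots-bound d       f-monic []       _ _ = z≤n
  roots-bound zero    f-monic (x ∷ xs) _ (fx≡0 ∷ _) = ⊥-elim (1≢0 (trans (sym (f-monic x)) fx≡0))
  roots-bound (suc d) {f} f-monic (a ∷ xs) (a∉xs ∷ u) (fa≡0 ∷ roots) with f-monic a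
  ... | g , g-monic , f≡ = s≤s (roots-bound d g-monic xs u (All.zipWith g-root (a∉xs , roots)))
    where
    g-root : ∀ {y} → a ≢ y × f y ≡ 0# → g y ≡ 0#
    g-root {y} (a≢y , fy≡0) = *-cancelˡ (g y) 0# (λ y-a≡0 → a≢y (sym (x-y≡0⇒x≡y y-a≡0))) (begin
      (y - a) * g y        ≡⟨ +-identityˡ _ ⟨
      0# + (y - a) * g y   ≡⟨ cong (_+ _) fa≡0 ⟨
      f a + (y - a) * g y  ≡⟨ f≡ y ⟨
      f y                  ≡⟨ fy≡0 ⟩
      0#                   ≡⟨ zeroʳ _ ⟨
      (y - a) * 0#         ∎)

prime⇒>1 : ∀ {p} → Prime p → 1 < p
prime⇒>1 {p} pr = ℕ.nonTrivial⇒n>1 p {{prime⇒nonTrivial pr}}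

prime∤! : ∀ {p} → Prime p → ∀ m → m < p → ¬ p ∣ m !
prime∤! pr zero    _   p∣1 = ℕ.<⇒≱ (prime⇒>1 pr) (∣⇒≤ p∣1)
prime∤! pr (suc m) m<p p∣m! with euclidsLemma (suc m) (m !) pr p∣m!
... | inj₁ p∣1+m = ℕ.<⇒≱ m<p (∣⇒≤ p∣1+m)
... | inj₂ p∣m!  = prime∤! pr m (ℕ.<-trans (ℕ.n<1+n m) m<p) p∣m!

prime⊥smaller : ∀ {p d} → Prime p → 0 < d → d < p → Coprime p d
prime⊥smaller pr 0<d d<p {c} (c∣p , c∣d) with prime⇒irreducible pr c∣p
... | inj₁ c≡1  = c≡1
... | inj₂ refl = ⊥-elim (ℕ.<⇒≱ d<p (∣⇒≤ {{ℕ.>-nonZero 0<d}} c∣d))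

n∣n! : ∀ {n} → 0 < n → n ∣ n !
n∣n! {suc n} _ = divides (n !) (ℕ.*-comm (suc n) (n !))

k![n∸k]!*nCk≡n! : ∀ {n k} → k ≤ n → k ! ℕ.* (n ∸ k) ! ℕ.* (n C k) ≡ n !
k![n∸k]!*nCk≡n! {n} {k} k≤n =
  trans (cong (k ! ℕ.* (n ∸ k) ! ℕ.*_) (nCk≡n!/k![n-k]! k≤n)) (m*[n/m]≡n (k![n∸k]!∣n! k≤n))
  where instance _ = ℕ._!*_!≢0 k (n ∸ k)

prime∣C : ∀ {p k} → Prime p → 0 < k → k < p → p ∣ p C k
prime∣C {p} {k} pr 0<k k<p
  with euclidsLemma (k ! ℕ.* (p ∸ k) !) (p C k) pr
         (subst (p ∣_) (sym (k![n∸k]!*nCk≡n! (ℕ.<⇒≤ k<p))) (n∣n! (ℕ.<-trans 0<k k<p)))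
... | inj₂ p∣C = p∣C
... | inj₁ p∣k![p-k]! with euclidsLemma (k !) ((p ∸ k) !) pr p∣k![p-k]!
...   | inj₁ p∣k!     = ⊥-elim (prime∤! pr k k<p p∣k!)
...   | inj₂ p∣[p-k]! = ⊥-elim (prime∤! pr (p ∸ k) (ℕ.∸-monoʳ-< {p} {k} {0} 0<k (ℕ.<⇒≤ k<p)) p∣[p-k]!)

module Frobenius (K : FiniteField) where
  open Field K
  open ≡-Reasoning
  open CommutativeRing commutativeRing using (semiring; commutativeSemiring)
  private
    module B = Algebra.Properties.CommutativeSemiring.Binomial commutativeSemiring
  open import Algebra.Properties.Semiring.Sum semiring using (sum)
  open import Algebra.Properties.Semiring.Mult semiring using () renaming (_×_ to _·_)
  open import Algebra.Properties.Semiring.Exp semiring using () renaming (_^_ to _^′_)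

  private
    ^′≡^ : ∀ x n → x ^′ n ≡ x ^ n
    ^′≡^ x zero    = refl
    ^′≡^ x (suc n) = cong (x *_) (^′≡^ x n)

    ·≡ι* : ∀ m x → m · x ≡ ι m * x
    ·≡ι* zero    x = sym (zeroˡ x)
    ·≡ι* (suc m) x = begin
      x + m · x          ≡⟨ cong₂ _+_ (sym (*-identityˡ x)) (·≡ι* m x) ⟩
      1# * x + ι m * x   ≡⟨ distribʳ _ _ _ ⟨
      (1# + ι m) * x     ∎

    sum-last : ∀ m (g : Fin (suc m) → Carrier) → (∀ i → g (Fin.inject₁ i) ≡ 0#) → sum g ≡ g (Fin.fromℕ m)
    sum-last zero    g _   = +-identityʳ _
    sum-last (suc m) g g≡0 = begin
      g Fin.zero + sum (g ∘′ Fin.suc) ≡⟨ cong (_+ sum (g ∘′ Fin.suc)) (g≡0 Fin.zero) ⟩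
      0# + sum (g ∘′ Fin.suc)         ≡⟨ +-identityˡ _ ⟩
      sum (g ∘′ Fin.suc)              ≡⟨ sum-last m (g ∘′ Fin.suc) (λ i → g≡0 (Fin.suc i)) ⟩
      g (Fin.suc (Fin.fromℕ m))       ∎

  -- In characteristic p all inner binomial coefficients of (x + y) ^ p vanish.
  frobenius-+ : ∀ {p} → Prime p → ι p ≡ 0# → ∀ x y → (x + y) ^ p ≡ x ^ p + y ^ p
  frobenius-+ {suc n} pr ιp≡0 x y = begin
    (x + y) ^ suc n                             ≡⟨ ^′≡^ (x + y) (suc n) ⟨
    (x + y) ^′ suc n                            ≡⟨ B.theorem (suc n) x y ⟩
    term Fin.zero + sum (λ i → term (Fin.suc i))
                                                ≡⟨ cong₂ _+_ first≡ (sum-last n (λ i → term (Fin.suc i)) middle≡0) ⟩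
    y ^ suc n + term (Fin.suc (Fin.fromℕ n))    ≡⟨ cong (y ^ suc n +_) last≡ ⟩
    y ^ suc n + x ^ suc n                       ≡⟨ +-comm _ _ ⟩
    x ^ suc n + y ^ suc n                       ∎
    where
    term : Fin (suc (suc n)) → Carrier
    term = B.binomialTerm x y (suc n)
    first≡ : term Fin.zero ≡ y ^ suc n
    first≡ = trans (+-identityʳ _) (trans (*-identityˡ _) (^′≡^ y (suc n)))
    last≡ : term (Fin.suc (Fin.fromℕ n)) ≡ x ^ suc n
    last≡ = begin
      (suc n C toℕ (Fin.fromℕ (suc n))) · (x ^′ toℕ (Fin.fromℕ (suc n)) * y ^′ (suc n ∸ toℕ (Fin.fromℕ (suc n))))
        ≡⟨ cong (λ t → (suc n C t) · (x ^′ t * y ^′ (suc n ∸ t))) (Fin.toℕ-fromℕ (suc n)) ⟩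
      (suc n C suc n) · (x ^′ suc n * y ^′ (n ∸ n))
        ≡⟨ cong₂ (λ c t → c · (x ^′ suc n * y ^′ t)) (nCn≡1 (suc n)) (ℕ.n∸n≡0 n) ⟩
      1 · (x ^′ suc n * 1#)  ≡⟨ +-identityʳ _ ⟩
      x ^′ suc n * 1#        ≡⟨ *-identityʳ _ ⟩
      x ^′ suc n             ≡⟨ ^′≡^ x (suc n) ⟩
      x ^ suc n              ∎
    middle≡0 : ∀ i → term (Fin.suc (Fin.inject₁ i)) ≡ 0#
    middle≡0 i with prime∣C pr (s≤s z≤n) (s≤s (subst (_< n) (sym (Fin.toℕ-inject₁ i)) (Fin.toℕ<n i)))
    ... | divides r C≡rp = begin
      (suc n C j) · t          ≡⟨ ·≡ι* (suc n C j) t ⟩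
      ι (suc n C j) * t        ≡⟨ cong (λ c → ι c * t) (trans C≡rp (ℕ.*-comm r (suc n))) ⟩
      ι (suc n ℕ.* r) * t      ≡⟨ cong (_* t) (ι-* (suc n) r) ⟩
      ι (suc n) * ι r * t      ≡⟨ cong (λ c → c * ι r * t) ιp≡0 ⟩
      0# * ι r * t             ≡⟨ trans (cong (_* t) (zeroˡ _)) (zeroˡ t) ⟩
      0#                       ∎
      where
      j : ℕ
      j = suc (toℕ (Fin.inject₁ i))
      t : Carrier
      t = x ^′ j * y ^′ (suc n ∸ j)

module PrimeField (K : FiniteField) {p} .{{_ : NonZero p}} (p-prime : Prime p)
                  (char-p : FiniteField.ι K p ≡ FiniteField.0# K) where
  open Field K public
  open PolynomialFunctions K public
  open Frobenius K public
  open ≡-Reasoning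

  ι-p* : ∀ m → ι (p ℕ.* m) ≡ 0#
  ι-p* m = trans (ι-* p m) (trans (cong (_* ι m) char-p) (zeroˡ _))

  ι-% : ∀ m → ι (m % p) ≡ ι m
  ι-% m = begin
    ι (m % p)                    ≡⟨ +-identityʳ _ ⟨
    ι (m % p) + 0#               ≡⟨ cong (ι (m % p) +_) (trans (cong ι (ℕ.*-comm (m / p) p)) (ι-p* (m / p))) ⟨
    ι (m % p) + ι (m / p ℕ.* p)  ≡⟨ ι-+ (m % p) (m / p ℕ.* p) ⟨
    ι (m % p ℕ.+ m / p ℕ.* p)    ≡⟨ cong ι (m≡m%n+[m/n]*n m p) ⟨
    ι m                          ∎

  ι-mod : ∀ m → ι (toℕ (m mod p)) ≡ ι m
  ι-mod m = trans (cong ι (Fin.toℕ-fromℕ< (m%n<n m p))) (ι-% m)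

  ι-∸ : ∀ {k} → k ≤ p → ι (p ∸ k) ≡ - ι k
  ι-∸ {k} k≤p = begin
    ι (p ∸ k)                  ≡⟨ solve 2 (λ a b → a := (a :+ b) :- b) refl (ι (p ∸ k)) (ι k) ⟩
    (ι (p ∸ k) + ι k) - ι k    ≡⟨ cong (_- ι k) (ι-+ (p ∸ k) k) ⟨
    ι (p ∸ k ℕ.+ k) - ι k      ≡⟨ cong (λ z → ι z - ι k) (ℕ.m∸n+n≡m k≤p) ⟩
    ι p - ι k                  ≡⟨ cong (_- ι k) char-p ⟩
    0# - ι k                   ≡⟨ +-identityˡ _ ⟩
    - ι k                      ∎

  -- A Bézout identity 1 + y d = x p (or 1 + x p = y d) becomes 1 = 0 once ι d = ι p = 0.
  ι≢0 : ∀ {d} → 0 < d → d < p → ι d ≢ 0#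
  ι≢0 {d} 0<d d<p ιd≡0 with coprime-Bézout (prime⊥smaller p-prime 0<d d<p)
  ... | Bézout.+- x y 1+yd≡xp = 0≢1 (sym (begin
    1#                 ≡⟨ +-identityʳ 1# ⟨
    1# + 0#            ≡⟨ cong (1# +_) (trans (ι-* y d) (trans (cong (ι y *_) ιd≡0) (zeroʳ _))) ⟨
    ι (1 ℕ.+ y ℕ.* d)  ≡⟨ cong ι 1+yd≡xp ⟩
    ι (x ℕ.* p)        ≡⟨ trans (cong ι (ℕ.*-comm x p)) (ι-p* x) ⟩
    0#                 ∎))
  ... | Bézout.-+ x y 1+xp≡yd = 0≢1 (sym (begin
    1#                 ≡⟨ +-identityʳ 1# ⟨
    1# + 0#            ≡⟨ cong (1# +_) (trans (cong ι (ℕ.*-comm x p)) (ι-p* x)) ⟨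
    ι (1 ℕ.+ x ℕ.* p)  ≡⟨ cong ι 1+xp≡yd ⟩
    ι (y ℕ.* d)        ≡⟨ trans (ι-* y d) (trans (cong (ι y *_) ιd≡0) (zeroʳ _)) ⟩
    0#                 ∎))

  ι-<-injective : ∀ {a b} → a < b → b < p → ι a ≢ ι b
  ι-<-injective {a} {b} a<b b<p ιa≡ιb = ι≢0 (ℕ.m<n⇒0<n∸m a<b) (ℕ.≤-<-trans (ℕ.m∸n≤m b a) b<p) (begin
    ι (b ∸ a)                  ≡⟨ solve 2 (λ c a → c := (c :+ a) :- a) refl (ι (b ∸ a)) (ι a) ⟩
    (ι (b ∸ a) + ι a) - ι a    ≡⟨ cong (_- ι a) (ι-+ (b ∸ a) a) ⟨
    ι (b ∸ a ℕ.+ a) - ι a      ≡⟨ cong (λ z → ι z - ι a) (ℕ.m∸n+n≡m (ℕ.<⇒≤ a<b)) ⟩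
    ι b - ι a                  ≡⟨ cong (_- ι a) ιa≡ιb ⟨
    ι a - ι a                  ≡⟨ -‿inverseʳ _ ⟩
    0#                         ∎)

  ιFin : Fin p → Carrier
  ιFin k = ι (toℕ k)

  ι-injective : ∀ (i j : Fin p) → ιFin i ≡ ιFin j → i ≡ j
  ι-injective i j ιi≡ιj with ℕ.<-cmp (toℕ i) (toℕ j)
  ... | tri< i<j _ _ = ⊥-elim (ι-<-injective i<j (Fin.toℕ<n j) ιi≡ιj)
  ... | tri≈ _ i≡j _ = Fin.toℕ-injective i≡j
  ... | tri> _ _ j<i = ⊥-elim (ι-<-injective j<i (Fin.toℕ<n i) (sym ιi≡ιj))

  InPrimeField : Carrier → Set
  InPrimeField y = ∃ λ k → ιFin k ≡ y

  module _ (y : Carrier) where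
    private
      -- primeFieldIndex runs a local search through allFin p; the meta below is solved by
      -- unification to that local function, so that it can be reasoned about on any list.
      mutual
        search : List (Fin p) → Fin p
        search = _

        search-allFin : search (allFin p) ≡ primeFieldIndex p y
        search-allFin with allFin p
        ... | ks = refl

      search-finds : ∀ {k} ks → k ∈ ks → ιFin k ≡ y → ιFin (search ks) ≡ y
      search-finds (k′ ∷ ks) k∈ ιk≡y with ιFin k′ ≟ y
      ... | yes ιk′≡y = ιk′≡y
      search-finds (k′ ∷ ks) (here refl)  ιk≡y | no ιk′≢y = ⊥-elim (ιk′≢y ιk≡y)
      search-finds (k′ ∷ ks) (there k∈ks) ιk≡y | no _     = search-finds ks k∈ks ιk≡y

    primeFieldIndex-correct : InPrimeField y → ιFin (primeFieldIndex p y) ≡ y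
    primeFieldIndex-correct (k , ιk≡y) =
      subst (λ i → ιFin i ≡ y) search-allFin (search-finds (allFin p) (∈-allFin k) ιk≡y)

  ι^p≡ι : ∀ m → ι m ^ p ≡ ι m
  ι^p≡ι zero    = 0^n≡0 (ℕ.<⇒≤ (prime⇒>1 p-prime))
  ι^p≡ι (suc m) = trans (frobenius-+ p-prime char-p 1# (ι m)) (cong₂ _+_ (1^n≡1 p) (ι^p≡ι m))

  -- x ^ p - x has degree p and vanishes on the p elements of the prime field.
  ^p-fixed⇒InPrimeField : ∀ {z} → z ^ p ≡ z → InPrimeField z
  ^p-fixed⇒InPrimeField {z} z^p≡z with Fin.any? (λ k → ιFin k ≟ z)
  ... | yes z∈ = z∈
  ... | no  z∉ = ⊥-elim (ℕ.<⇒≱ (s≤s (ℕ.≤-reflexive (sym #primeField≡p)))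
                                (roots-bound p x^p-x-monic (z ∷ primeField) unique-roots roots))
    where
    x^p-x : Carrier → Carrier
    x^p-x x = x ^ p + (- 1#) * x ^ 1
    x^p-x-monic : Monic p x^p-x
    x^p-x-monic = Monic-+ (prime⇒>1 p-prime) (Monic-^ p)
                          (Degree≤-scale 1 (- 1#) (Monic⇒Degree≤ 1 (Monic-^ 1)))
    fixed⇒root : ∀ {x} → x ^ p ≡ x → x^p-x x ≡ 0#
    fixed⇒root {x} x^p≡x = begin
      x ^ p + (- 1#) * (x * 1#)  ≡⟨ cong₂ (λ a b → a + (- 1#) * b) x^p≡x (*-identityʳ x) ⟩
      x + (- 1#) * x             ≡⟨ cong (x +_) (-‿distribˡ-* 1# x) ⟨
      x - 1# * x                 ≡⟨ cong (λ w → x - w) (*-identityˡ x) ⟩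
      x - x                      ≡⟨ -‿inverseʳ x ⟩
      0#                         ∎
    primeField : List Carrier
    primeField = map ιFin (allFin p)
    #primeField≡p : length primeField ≡ p
    #primeField≡p = trans (length-map _ (allFin p)) (length-tabulate (λ k → k))
    unique-roots : Unique (z ∷ primeField)
    unique-roots = All.tabulate (λ w∈ z≡w → let k , _ , w≡ιk = ∈-map⁻ ιFin w∈ in z∉ (k , sym (trans z≡w w≡ιk)))
                 ∷ Unique.map⁺ (ι-injective _ _) (Unique.allFin⁺ p)
    roots : All (λ x → x^p-x x ≡ 0#) (z ∷ primeField)
    roots = fixed⇒root z^p≡z ∷ All.tabulate λ w∈ →
      let k , _ , w≡ιk = ∈-map⁻ ιFin w∈ in subst (λ w → x^p-x w ≡ 0#) (sym w≡ιk) (fixed⇒root (ι^p≡ι (toℕ k)))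

module Trace (K : FiniteField) {p} .{{_ : NonZero p}} (p-prime : Prime p)
             (char-p : FiniteField.ι K p ≡ FiniteField.0# K)
             (n : ℕ) (order≡p^n : FiniteField.order K ≡ p ℕ.^ n) where
  open PrimeField K p-prime char-p public
  open ≡-Reasoning

  Tr : Carrier → Carrier
  Tr = trace p n

  frobenius-^ : ∀ i x y → (x + y) ^ (p ℕ.^ i) ≡ x ^ (p ℕ.^ i) + y ^ (p ℕ.^ i)
  frobenius-^ zero    x y = trans (*-identityʳ _) (sym (cong₂ _+_ (*-identityʳ x) (*-identityʳ y)))
  frobenius-^ (suc i) x y = begin
    (x + y) ^ (p ℕ.* p ℕ.^ i)                  ≡⟨ ^-*-assoc (x + y) p (p ℕ.^ i) ⟨
    ((x + y) ^ p) ^ (p ℕ.^ i)                  ≡⟨ cong (_^ (p ℕ.^ i)) (frobenius-+ p-prime char-p x y) ⟩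
    (x ^ p + y ^ p) ^ (p ℕ.^ i)                ≡⟨ frobenius-^ i _ _ ⟩
    (x ^ p) ^ (p ℕ.^ i) + (y ^ p) ^ (p ℕ.^ i)
                                               ≡⟨ cong₂ _+_ (^-*-assoc x p (p ℕ.^ i)) (^-*-assoc y p (p ℕ.^ i)) ⟩
    x ^ (p ℕ.* p ℕ.^ i) + y ^ (p ℕ.* p ℕ.^ i)  ∎

  trace-+ : ∀ m x y → trace p m (x + y) ≡ trace p m x + trace p m y
  trace-+ zero    x y = sym (+-identityˡ 0#)
  trace-+ (suc m) x y = begin
    (x + y) ^ (p ℕ.^ m) + trace p m (x + y)
      ≡⟨ cong₂ _+_ (frobenius-^ m x y) (trace-+ m x y) ⟩
    (x ^ (p ℕ.^ m) + y ^ (p ℕ.^ m)) + (trace p m x + trace p m y)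
      ≡⟨ +-interchange _ _ _ _ ⟩
    (x ^ (p ℕ.^ m) + trace p m x) + (y ^ (p ℕ.^ m) + trace p m y) ∎

  Tr-0 : Tr 0# ≡ 0#
  Tr-0 = begin
    Tr 0#                   ≡⟨ solve 1 (λ a → a := (a :+ a) :- a) refl (Tr 0#) ⟩
    (Tr 0# + Tr 0#) - Tr 0# ≡⟨ cong (_- Tr 0#) (trace-+ n 0# 0#) ⟨
    Tr (0# + 0#) - Tr 0#    ≡⟨ cong (λ z → Tr z - Tr 0#) (+-identityˡ 0#) ⟩
    Tr 0# - Tr 0#           ≡⟨ -‿inverseʳ _ ⟩
    0#                      ∎

  Tr-neg : ∀ x → Tr (- x) ≡ - Tr x
  Tr-neg x = begin
    Tr (- x)                   ≡⟨ solve 2 (λ a b → a := (b :+ a) :- b) refl (Tr (- x)) (Tr x) ⟩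
    (Tr x + Tr (- x)) - Tr x   ≡⟨ cong (_- Tr x) (trace-+ n x (- x)) ⟨
    Tr (x - x) - Tr x          ≡⟨ cong (λ z → Tr z - Tr x) (-‿inverseʳ x) ⟩
    Tr 0# - Tr x               ≡⟨ cong (_- Tr x) Tr-0 ⟩
    0# - Tr x                  ≡⟨ +-identityˡ _ ⟩
    - Tr x                     ∎

  ^p^i-fixed : ∀ {c} → c ^ p ≡ c → ∀ i → c ^ (p ℕ.^ i) ≡ c
  ^p^i-fixed c^p≡c zero    = *-identityʳ _
  ^p^i-fixed {c} c^p≡c (suc i) = trans (sym (^-*-assoc c p (p ℕ.^ i)))
                                       (trans (cong (_^ (p ℕ.^ i)) c^p≡c) (^p^i-fixed c^p≡c i))

  trace-* : ∀ {c} → c ^ p ≡ c → ∀ m x → trace p m (c * x) ≡ c * trace p m x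
  trace-* {c} c^p≡c zero    x = sym (zeroʳ c)
  trace-* {c} c^p≡c (suc m) x = begin
    (c * x) ^ (p ℕ.^ m) + trace p m (c * x)
      ≡⟨ cong₂ _+_ (^-distribʳ-* c x (p ℕ.^ m)) (trace-* c^p≡c m x) ⟩
    c ^ (p ℕ.^ m) * x ^ (p ℕ.^ m) + c * trace p m x
      ≡⟨ cong (λ z → z * x ^ (p ℕ.^ m) + c * trace p m x) (^p^i-fixed c^p≡c m) ⟩
    c * x ^ (p ℕ.^ m) + c * trace p m x
      ≡⟨ distribˡ _ _ _ ⟨
    c * (x ^ (p ℕ.^ m) + trace p m x) ∎

  trace^p : ∀ m x → trace p m x ^ p + x ≡ x ^ (p ℕ.^ m) + trace p m x
  trace^p zero    x = begin
    0# ^ p + x      ≡⟨ cong (_+ x) (0^n≡0 (ℕ.<⇒≤ (prime⇒>1 p-prime))) ⟩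
    0# + x          ≡⟨ +-comm _ _ ⟩
    x + 0#          ≡⟨ cong (_+ 0#) (*-identityʳ x) ⟨
    x ^ 1 + 0#      ∎
  trace^p (suc m) x = begin
    (x ^ (p ℕ.^ m) + trace p m x) ^ p + x
      ≡⟨ cong (_+ x) (frobenius-+ p-prime char-p _ _) ⟩
    ((x ^ (p ℕ.^ m)) ^ p + trace p m x ^ p) + x
      ≡⟨ +-assoc _ _ _ ⟩
    (x ^ (p ℕ.^ m)) ^ p + (trace p m x ^ p + x)
      ≡⟨ cong₂ _+_ (trans (^-*-assoc x (p ℕ.^ m) p) (cong (x ^_) (ℕ.*-comm (p ℕ.^ m) p))) (trace^p m x) ⟩
    x ^ (p ℕ.* p ℕ.^ m) + (x ^ (p ℕ.^ m) + trace p m x) ∎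

  Tr^p≡Tr : ∀ x → Tr x ^ p ≡ Tr x
  Tr^p≡Tr x = begin
    Tr x ^ p                    ≡⟨ solve 2 (λ a b → a := (a :+ b) :- b) refl (Tr x ^ p) x ⟩
    (Tr x ^ p + x) - x          ≡⟨ cong (_- x) (trace^p n x) ⟩
    (x ^ (p ℕ.^ n) + Tr x) - x  ≡⟨ cong (λ z → (z + Tr x) - x) x^[p^n]≡x ⟩
    (x + Tr x) - x              ≡⟨ solve 2 (λ a b → (a :+ b) :- a := b) refl x (Tr x) ⟩
    Tr x                        ∎
    where
    x^[p^n]≡x : x ^ (p ℕ.^ n) ≡ x
    x^[p^n]≡x = trans (cong (x ^_) (sym order≡p^n)) (x^order≡x x)

  Tr-InPrimeField : ∀ x → InPrimeField (Tr x)
  Tr-InPrimeField x = ^p-fixed⇒InPrimeField (Tr^p≡Tr x)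

  private
    p^m≢0 : ∀ m → NonZero (p ℕ.^ m)
    p^m≢0 m = ℕ.m^n≢0 p m

    p^m<p^[1+m] : ∀ m → p ℕ.^ m < p ℕ.^ suc m
    p^m<p^[1+m] m = subst (p ℕ.^ m <_) (ℕ.*-comm (p ℕ.^ m) p) (ℕ.m<m*n _ _ {{p^m≢0 m}} (prime⇒>1 p-prime))

  trace-Degree≤ : ∀ m → Degree≤ (pred (p ℕ.^ m)) (trace p m)
  trace-monic : ∀ m → Monic (p ℕ.^ m) (trace p (suc m))
  trace-Degree≤ zero    x y = refl
  trace-Degree≤ (suc m) =
    Degree≤-mono (ℕ.suc[m]≤n⇒m≤pred[n] (p^m<p^[1+m] m)) (Monic⇒Degree≤ _ (trace-monic m))
  trace-monic m =
    Monic-+ (ℕ.m≤pred[n]⇒suc[m]≤n {{p^m≢0 m}} ℕ.≤-refl) (Monic-^ (p ℕ.^ m)) (trace-Degree≤ m)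

  -- The trace is a polynomial of degree q / p, so it cannot vanish on all q elements.
  ∃Tr≢0 : ∃ λ t → Tr t ≢ 0#
  ∃Tr≢0 = nonroot n order≡p^n
    where
    nonroot : ∀ m → order ≡ p ℕ.^ m → ∃ λ t → trace p m t ≢ 0#
    nonroot zero    order≡1 = ⊥-elim (ℕ.<-irrefl (sym order≡1) 1<order)
    nonroot (suc m) order≡p^[1+m] with All.all? (λ x → trace p (suc m) x ≟ 0#) elements
    ... | no  ¬all = satisfied (¬All⇒Any¬ (λ x → trace p (suc m) x ≟ 0#) elements ¬all)
    ... | yes all  = ⊥-elim (ℕ.<⇒≱ (subst (p ℕ.^ m <_) (sym order≡p^[1+m]) (p^m<p^[1+m] m))
                                   (roots-bound _ (trace-monic m) elements unique all))

  ∃Tr≡1 : ∃ λ t → Tr t ≡ 1#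
  ∃Tr≡1 = let t , Trt≢0 = ∃Tr≢0 in
    Tr t ⁻¹ * t , trans (trace-* (Tr⁻¹-fixed Trt≢0) n t) (inverseˡ Trt≢0)
    where
    Tr⁻¹-fixed : ∀ {t} → Tr t ≢ 0# → (Tr t ⁻¹) ^ p ≡ Tr t ⁻¹
    Tr⁻¹-fixed {t} Trt≢0 = trans (⁻¹-^ p Trt≢0) (cong _⁻¹ (Tr^p≡Tr t))

module CyclotomicSums (p : ℕ) .{{_ : NonZero p}} where
  open Cyclotomic p public

  infix 4 _≐_
  _≐_ : ℤζ → ℤζ → Set
  a ≐ b = ∀ k → a k ≡ b k

  ≐⇒≈ : ∀ {a b} → a ≐ b → a ≈ b
  ≐⇒≈ a≐b = ℤ.0ℤ , λ k → trans (a≐b k) (sym (ℤ.+-identityʳ _))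

  ≈-refl : ∀ {a} → a ≈ a
  ≈-refl = ≐⇒≈ (λ _ → refl)

  ≈-sym : ∀ {a b} → a ≈ b → b ≈ a
  ≈-sym {a} {b} (c , a≡b+c) = ℤ.- c , λ k → begin
    b k                   ≡⟨ +-cancel (b k) c ⟨
    (b k ℤ.+ c) ℤ.- c     ≡⟨ cong (ℤ._- c) (a≡b+c k) ⟨
    a k ℤ.- c             ∎
    where
    open ≡-Reasoning
    +-cancel : ∀ x y → (x ℤ.+ y) ℤ.- y ≡ x
    +-cancel = solve-∀

  ≈-trans : ∀ {a b c} → a ≈ b → b ≈ c → a ≈ c
  ≈-trans {c = c} (c₁ , a≡b+c₁) (c₂ , b≡c+c₂) = c₂ ℤ.+ c₁ , λ k →
    trans (a≡b+c₁ k) (trans (cong (ℤ._+ c₁) (b≡c+c₂ k)) (ℤ.+-assoc (c k) c₂ c₁))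

  +ζ-cong : ∀ {a a′ b b′} → a ≈ a′ → b ≈ b′ → (a +ζ b) ≈ (a′ +ζ b′)
  +ζ-cong {a} {a′} {b} {b′} (c₁ , a≡) (c₂ , b≡) = c₁ ℤ.+ c₂ , λ k → begin
    a k ℤ.+ b k                              ≡⟨ cong₂ ℤ._+_ (a≡ k) (b≡ k) ⟩
    (a′ k ℤ.+ c₁) ℤ.+ (b′ k ℤ.+ c₂)          ≡⟨ interchange (a′ k) (b′ k) c₁ c₂ ⟩
    (a′ k ℤ.+ b′ k) ℤ.+ (c₁ ℤ.+ c₂)          ∎
    where
    open ≡-Reasoning
    interchange : ∀ x y u v → (x ℤ.+ u) ℤ.+ (y ℤ.+ v) ≡ (x ℤ.+ y) ℤ.+ (u ℤ.+ v)
    interchange = solve-∀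

  ≐-commutativeMonoid : CommutativeMonoid 0ℓ 0ℓ
  ≐-commutativeMonoid = record
    { _≈_ = _≐_ ; _∙_ = _+ζ_ ; ε = zeroζ
    ; isCommutativeMonoid = Pointwise.isCommutativeMonoid (Fin p) ℤ.+-0-isCommutativeMonoid }

  ≈-commutativeMonoid : CommutativeMonoid 0ℓ 0ℓ
  ≈-commutativeMonoid = record
    { _≈_ = _≈_ ; _∙_ = _+ζ_ ; ε = zeroζ
    ; isCommutativeMonoid = record
      { isMonoid = record
        { isSemigroup = record
          { isMagma = record
            { isEquivalence = record
              { refl  = λ {a} → ≈-refl {a}
              ; sym   = λ {a} {b} → ≈-sym {a} {b}
              ; trans = λ {a} {b} {c} → ≈-trans {a} {b} {c} }
            ; ∙-cong = λ {a} {a′} {b} {b′} → +ζ-cong {a} {a′} {b} {b′} }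
          ; assoc = λ a b c → ≐⇒≈ λ k → ℤ.+-assoc (a k) (b k) (c k) }
        ; identity = (λ a → ≐⇒≈ λ k → ℤ.+-identityˡ (a k)) , (λ a → ≐⇒≈ λ k → ℤ.+-identityʳ (a k)) }
      ; comm = λ a b → ≐⇒≈ λ k → ℤ.+-comm (a k) (b k) } }

  module ≐-Reasoning = Relation.Binary.Reasoning.Setoid (CommutativeMonoid.setoid ≐-commutativeMonoid)
  module ≈-Reasoning = Relation.Binary.Reasoning.Setoid (CommutativeMonoid.setoid ≈-commutativeMonoid)

  ≈0-cancelʳ : ∀ a {b} c → b ≈ zeroζ → (a +ζ b) ≈ c → a ≈ c
  ≈0-cancelʳ a {b} c b≈0 a+b≈c = begin
    a            ≈⟨ identityʳ a ⟨
    a +ζ zeroζ   ≈⟨ ∙-congˡ {a} {zeroζ} {b} (≈-sym {b} {zeroζ} b≈0) ⟩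
    a +ζ b       ≈⟨ a+b≈c ⟩
    c            ∎
    where
    open ≈-Reasoning
    open CommutativeMonoid ≈-commutativeMonoid using (∙-congˡ; identityʳ)

  module ζΣ = ListSum ≐-commutativeMonoid
  module ≈Σ = ListSum ≈-commutativeMonoid
  module ℤΣ = ListSum-* ℤ.+-*-semiring

  private variable A : Set

  sumOver-apply : ∀ (F : A → ℤζ) xs k → ζΣ.sumOver F xs k ≡ ℤΣ.sumOver (λ x → F x k) xs
  sumOver-apply F []       k = refl
  sumOver-apply F (x ∷ xs) k = cong (λ z → F x k ℤ.+ z) (sumOver-apply F xs k)

  *ζ-congʳ : ∀ a {b b′} → b ≐ b′ → (a *ζ b) ≐ (a *ζ b′)
  *ζ-congʳ a b≐b′ k = ℤΣ.sumOver-cong (allFin p) (λ {i} _ → cong (a i ℤ.*_) (b≐b′ (k ⊕ (⊖ i))))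

  *ζ-distribʳ-sumOver : ∀ (F : A → ℤζ) xs b → (ζΣ.sumOver F xs *ζ b) ≐ ζΣ.sumOver (λ x → F x *ζ b) xs
  *ζ-distribʳ-sumOver F xs b k = begin
    ℤΣ.sumOver (λ i → ζΣ.sumOver F xs i ℤ.* b (k ⊕ (⊖ i))) (allFin p)
      ≡⟨ ℤΣ.sumOver-cong (allFin p) (λ {i} _ → trans (cong (ℤ._* b (k ⊕ (⊖ i))) (sumOver-apply F xs i))
                                                      (ℤΣ.sumOver-*ʳ (λ x → F x i) (b (k ⊕ (⊖ i))) xs)) ⟩
    ℤΣ.sumOver (λ i → ℤΣ.sumOver (λ x → F x i ℤ.* b (k ⊕ (⊖ i))) xs) (allFin p)
      ≡⟨ ℤΣ.sumOver-swap (λ i x → F x i ℤ.* b (k ⊕ (⊖ i))) (allFin p) xs ⟩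
    ℤΣ.sumOver (λ x → (F x *ζ b) k) xs
      ≡⟨ sumOver-apply (λ x → F x *ζ b) xs k ⟨
    ζΣ.sumOver (λ x → F x *ζ b) xs k ∎
    where open ≡-Reasoning

  *ζ-distribˡ-sumOver : ∀ a (G : A → ℤζ) ys → (a *ζ ζΣ.sumOver G ys) ≐ ζΣ.sumOver (λ y → a *ζ G y) ys
  *ζ-distribˡ-sumOver a G ys k = begin
    ℤΣ.sumOver (λ i → a i ℤ.* ζΣ.sumOver G ys (k ⊕ (⊖ i))) (allFin p)
      ≡⟨ ℤΣ.sumOver-cong (allFin p) (λ {i} _ → trans (cong (a i ℤ.*_) (sumOver-apply G ys (k ⊕ (⊖ i))))
                                                      (ℤΣ.sumOver-*ˡ (λ y → G y (k ⊕ (⊖ i))) (a i) ys)) ⟩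
    ℤΣ.sumOver (λ i → ℤΣ.sumOver (λ y → a i ℤ.* G y (k ⊕ (⊖ i))) ys) (allFin p)
      ≡⟨ ℤΣ.sumOver-swap (λ i y → a i ℤ.* G y (k ⊕ (⊖ i))) (allFin p) ys ⟩
    ℤΣ.sumOver (λ y → (a *ζ G y) k) ys
      ≡⟨ sumOver-apply (λ y → a *ζ G y) ys k ⟨
    ζΣ.sumOver (λ y → a *ζ G y) ys k ∎
    where open ≡-Reasoning

  conj-sumOver : ∀ (F : A → ℤζ) xs → conj (ζΣ.sumOver F xs) ≐ ζΣ.sumOver (conj ∘ F) xs
  conj-sumOver F xs k = trans (sumOver-apply F xs (⊖ k)) (sym (sumOver-apply (conj ∘ F) xs k))

  fromℕ-+ : ∀ m n → (fromℕ m +ζ fromℕ n) ≐ fromℕ (m ℕ.+ n)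
  fromℕ-+ m n k with toℕ k
  ... | zero  = refl
  ... | suc _ = refl

  sumOver-fromℕ : ∀ m (xs : List A) → ζΣ.sumOver (λ _ → fromℕ m) xs ≐ fromℕ (length xs ℕ.* m)
  sumOver-fromℕ m []       k with toℕ k
  ... | zero  = refl
  ... | suc _ = refl
  sumOver-fromℕ m (x ∷ xs) k =
    trans (cong (λ z → fromℕ m k ℤ.+ z) (sumOver-fromℕ m xs k)) (fromℕ-+ m (length xs ℕ.* m) k)

module AdditiveCharacter (K : FiniteField) {p} .{{_ : NonZero p}} (p-prime : Prime p)
                         (char-p : FiniteField.ι K p ≡ FiniteField.0# K)
                         (n : ℕ) (order≡p^n : FiniteField.order K ≡ p ℕ.^ n) where
  open Trace K p-prime char-p n order≡p^n public
  open CyclotomicSums p public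
  open ≡-Reasoning

  ιFin-⊕ : ∀ i j → ιFin (i ⊕ j) ≡ ιFin i + ιFin j
  ιFin-⊕ i j = trans (ι-mod (toℕ i ℕ.+ toℕ j)) (ι-+ (toℕ i) (toℕ j))

  ιFin-⊖ : ∀ i → ιFin (⊖ i) ≡ - ιFin i
  ιFin-⊖ i = trans (ι-mod (p ℕ.∸ toℕ i)) (ι-∸ (ℕ.<⇒≤ (Fin.toℕ<n i)))

  ιFin-⊕⊖ : ∀ i j → ιFin (i ⊕ (⊖ j)) ≡ ιFin i - ιFin j
  ιFin-⊕⊖ i j = trans (ιFin-⊕ i (⊖ j)) (cong (ιFin i +_) (ιFin-⊖ j))

  fromℤ-0 : ∀ m i → ιFin i ≡ 0# → fromℤ m i ≡ m
  fromℤ-0 m i ιi≡0 with toℕ i in toℕi≡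
  ... | zero  = refl
  ... | suc k = ⊥-elim (ι≢0 (ℕ.s≤s ℕ.z≤n) (subst (_< p) toℕi≡ (Fin.toℕ<n i)) ιi≡0)

  fromℤ-≢0 : ∀ m i → ιFin i ≢ 0# → fromℤ m i ≡ ℤ.0ℤ
  fromℤ-≢0 m i ιi≢0 with toℕ i in toℕi≡
  ... | zero  = ⊥-elim (ιi≢0 refl)
  ... | suc _ = refl

  -- Whether ζ^ a k is 1 or 0 depends only on whether ιFin k - ιFin a vanishes.
  ζ^-resp : ∀ a b k l c → c ≢ 0# → ιFin k - ιFin a ≡ c * (ιFin l - ιFin b) → ζ^ a k ≡ ζ^ b l
  ζ^-resp a b k l c c≢0 dk≡c*dl with (ιFin l - ιFin b) ≟ 0#
  ... | yes dl≡0 =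
    trans (fromℤ-0 _ (k ⊕ (⊖ a)) ι[k-a]≡0) (sym (fromℤ-0 _ (l ⊕ (⊖ b)) (trans (ιFin-⊕⊖ l b) dl≡0)))
    where
    ι[k-a]≡0 : ιFin (k ⊕ (⊖ a)) ≡ 0#
    ι[k-a]≡0 = trans (ιFin-⊕⊖ k a) (trans dk≡c*dl (trans (cong (c *_) dl≡0) (zeroʳ c)))
  ... | no  dl≢0 = trans (fromℤ-≢0 _ (k ⊕ (⊖ a)) ι[k-a]≢0) (sym (fromℤ-≢0 _ (l ⊕ (⊖ b)) ι[l-b]≢0))
    where
    ι[k-a]≢0 : ιFin (k ⊕ (⊖ a)) ≢ 0#
    ι[k-a]≢0 = λ dk≡0 → *-≢0 c≢0 dl≢0 (trans (sym dk≡c*dl) (trans (sym (ιFin-⊕⊖ k a)) dk≡0))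
    ι[l-b]≢0 : ιFin (l ⊕ (⊖ b)) ≢ 0#
    ι[l-b]≢0 = λ dl≡0 → dl≢0 (trans (sym (ιFin-⊕⊖ l b)) dl≡0)

  ζ^-self : ∀ a → ζ^ a a ≡ ℤ.1ℤ
  ζ^-self a = fromℤ-0 _ (a ⊕ (⊖ a)) (trans (ιFin-⊕⊖ a a) (-‿inverseʳ _))

  ζ^-other : ∀ a k → k ≢ a → ζ^ a k ≡ ℤ.0ℤ
  ζ^-other a k k≢a =
    fromℤ-≢0 _ (k ⊕ (⊖ a)) (λ d≡0 → k≢a (ι-injective k a (x-y≡0⇒x≡y (trans (sym (ιFin-⊕⊖ k a)) d≡0))))

  ζ^-*-shift : ∀ a b → (ζ^ a *ζ b) ≐ (λ k → b (k ⊕ (⊖ a)))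
  ζ^-*-shift a b k = begin
    ℤΣ.sumOver (λ i → ζ^ a i ℤ.* b (k ⊕ (⊖ i))) (allFin p)
      ≡⟨ ℤΣ.sumOver-δ (allFin p) (Unique.allFin⁺ p) (∈-allFin a)
                      (λ {i} _ i≢a → cong (ℤ._* b (k ⊕ (⊖ i))) (ζ^-other a i i≢a)) ⟩
    ζ^ a a ℤ.* b (k ⊕ (⊖ a))  ≡⟨ cong (ℤ._* b (k ⊕ (⊖ a))) (ζ^-self a) ⟩
    ℤ.1ℤ ℤ.* b (k ⊕ (⊖ a))    ≡⟨ ℤ.*-identityˡ _ ⟩
    b (k ⊕ (⊖ a))             ∎

  ζ^-* : ∀ a b → (ζ^ a *ζ ζ^ b) ≐ ζ^ (a ⊕ b)
  ζ^-* a b k = trans (ζ^-*-shift a (ζ^ b) k) (ζ^-resp b (a ⊕ b) (k ⊕ (⊖ a)) k 1# 1≢0 (begin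
    ιFin (k ⊕ (⊖ a)) - ιFin b           ≡⟨ cong (_- ιFin b) (ιFin-⊕⊖ k a) ⟩
    (ιFin k - ιFin a) - ιFin b          ≡⟨ solve 3 (λ k a b → (k :- a) :- b := k :- (a :+ b)) refl _ _ _ ⟩
    ιFin k - (ιFin a + ιFin b)          ≡⟨ *-identityˡ _ ⟨
    1# * (ιFin k - (ιFin a + ιFin b))   ≡⟨ cong (λ z → 1# * (ιFin k - z)) (ιFin-⊕ a b) ⟨
    1# * (ιFin k - ιFin (a ⊕ b))        ∎))

  conj-ζ^ : ∀ a → conj (ζ^ a) ≐ ζ^ (⊖ a)
  conj-ζ^ a k = ζ^-resp a (⊖ a) (⊖ k) k (- 1#) (1≢0 ∘ -x≡0⇒x≡0) (begin
    ιFin (⊖ k) - ιFin a                 ≡⟨ cong (_- ιFin a) (ιFin-⊖ k) ⟩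
    - ιFin k - ιFin a                   ≡⟨ solve 2 (λ k a → :- k :- a := :- (k :- :- a)) refl _ _ ⟩
    - (ιFin k - - ιFin a)               ≡⟨ cong -_ (*-identityˡ _) ⟨
    - (1# * (ιFin k - - ιFin a))        ≡⟨ -‿distribˡ-* 1# _ ⟩
    (- 1#) * (ιFin k - - ιFin a)        ≡⟨ cong (λ z → (- 1#) * (ιFin k - z)) (ιFin-⊖ a) ⟨
    (- 1#) * (ιFin k - ιFin (⊖ a))      ∎)

  rotation-invariant⇒≈0 : ∀ {a : ℤζ} i → ιFin i ≡ 1# → (∀ k → a (k ⊕ (⊖ i)) ≡ a k) → a ≈ zeroζ
  rotation-invariant⇒≈0 {a} i ιi≡1 invariant =
    a k₀ , λ k → trans (≡-a₀ (toℕ k) k refl) (sym (ℤ.+-identityˡ _))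
    where
    0<p : 0 < p
    0<p = ℕ.<-trans (ℕ.s≤s ℕ.z≤n) (prime⇒>1 p-prime)
    k₀ : Fin p
    k₀ = fromℕ< 0<p
    ≡-a₀ : ∀ m k → toℕ k ≡ m → a k ≡ a k₀
    ≡-a₀ zero    k toℕk≡0 = cong a (Fin.toℕ-injective (trans toℕk≡0 (sym (Fin.toℕ-fromℕ< 0<p))))
    ≡-a₀ (suc m) k toℕk≡1+m =
      trans (sym (invariant k)) (trans (cong a k⊖i≡m) (≡-a₀ m (fromℕ< m<p) (Fin.toℕ-fromℕ< m<p)))
      where
      m<p : m < p
      m<p = ℕ.<-trans (ℕ.n<1+n m) (subst (_< p) toℕk≡1+m (Fin.toℕ<n k))
      k⊖i≡m : k ⊕ (⊖ i) ≡ fromℕ< m<p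
      k⊖i≡m = ι-injective (k ⊕ (⊖ i)) (fromℕ< m<p) (begin
        ιFin (k ⊕ (⊖ i))     ≡⟨ ιFin-⊕⊖ k i ⟩
        ιFin k - ιFin i      ≡⟨ cong₂ (λ x y → x - y) (cong ι toℕk≡1+m) ιi≡1 ⟩
        (1# + ι m) - 1#      ≡⟨ solve 2 (λ o x → (o :+ x) :- o := x) refl 1# (ι m) ⟩
        ι m                  ≡⟨ cong ι (Fin.toℕ-fromℕ< m<p) ⟨
        ιFin (fromℕ< m<p)    ∎)

  trIndex : Carrier → Fin p
  trIndex x = primeFieldIndex p (Tr x)

  ιFin-trIndex : ∀ x → ιFin (trIndex x) ≡ Tr x
  ιFin-trIndex x = primeFieldIndex-correct (Tr x) (Tr-InPrimeField x)

  ψ : Carrier → ℤζ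
  ψ x = ζ^ (trIndex x)

  ψ-+ : ∀ x y → (ψ x *ζ ψ y) ≐ ψ (x + y)
  ψ-+ x y k = trans (ζ^-* (trIndex x) (trIndex y) k)
                    (cong (λ i → ζ^ i k) (ι-injective (trIndex x ⊕ trIndex y) (trIndex (x + y)) (begin
    ιFin (trIndex x ⊕ trIndex y)          ≡⟨ ιFin-⊕ (trIndex x) (trIndex y) ⟩
    ιFin (trIndex x) + ιFin (trIndex y)   ≡⟨ cong₂ _+_ (ιFin-trIndex x) (ιFin-trIndex y) ⟩
    Tr x + Tr y                           ≡⟨ trace-+ n x y ⟨
    Tr (x + y)                            ≡⟨ ιFin-trIndex (x + y) ⟨
    ιFin (trIndex (x + y))                ∎)))

  conj-ψ : ∀ x → conj (ψ x) ≐ ψ (- x)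
  conj-ψ x k = trans (conj-ζ^ (trIndex x) k)
                     (cong (λ i → ζ^ i k) (ι-injective (⊖ trIndex x) (trIndex (- x)) (begin
    ιFin (⊖ trIndex x)     ≡⟨ ιFin-⊖ (trIndex x) ⟩
    - ιFin (trIndex x)     ≡⟨ cong -_ (ιFin-trIndex x) ⟩
    - Tr x                 ≡⟨ Tr-neg x ⟨
    Tr (- x)               ≡⟨ ιFin-trIndex (- x) ⟨
    ιFin (trIndex (- x))   ∎)))

  ψ-0 : ψ 0# ≐ fromℕ 1
  ψ-0 k = cong (fromℤ (ℤ.+ 1)) (ι-injective (k ⊕ (⊖ trIndex 0#)) k (begin
    ιFin (k ⊕ (⊖ trIndex 0#))   ≡⟨ ιFin-⊕⊖ k (trIndex 0#) ⟩
    ιFin k - ιFin (trIndex 0#)  ≡⟨ cong (λ z → ιFin k - z) (trans (ιFin-trIndex 0#) Tr-0) ⟩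
    ιFin k - 0#                 ≡⟨ trans (cong (ιFin k +_) -0#≈0#) (+-identityʳ _) ⟩
    ιFin k                      ∎))

  ΣK : (Carrier → ℤζ) → ℤζ
  ΣK F = ζΣ.sumOver F elements

  ΣK× : (Carrier → ℤζ) → ℤζ
  ΣK× F = ζΣ.sumOver F units

  ΣK-reindex : ∀ (F : Carrier → ℤζ) f g → (∀ x → g (f x) ≡ x) → (∀ y → f (g y) ≡ y) → ΣK (F ∘ f) ≐ ΣK F
  ΣK-reindex F f g g∘f f∘g k = trans (cong (λ S → S k) (sym (ζΣ.sumOver-map F f elements)))
    (ζΣ.sumOver-↭ F (map-inverse-↭ f g g∘f f∘g unique (λ _ → complete _) (λ _ → complete _)) k)

  ΣK×+term0 : ∀ F → (ΣK× F +ζ F 0#) ≐ ΣK F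
  ΣK×+term0 F k = trans (ℤ.+-comm (ΣK× F k) (F 0# k)) (sym (ζΣ.sumOver-↭ F elements↭0∷units k))

  sumOver-ΣK×+term0 : ∀ {A : Set} (G : A → Carrier → ℤζ) xs →
                      (ζΣ.sumOver (ΣK× ∘ G) xs +ζ ζΣ.sumOver (λ a → G a 0#) xs) ≐ ζΣ.sumOver (ΣK ∘ G) xs
  sumOver-ΣK×+term0 G xs k = trans (sym (ζΣ.sumOver-∙ (ΣK× ∘ G) (λ a → G a 0#) xs k))
                                   (ζΣ.sumOver-cong xs (λ {a} _ → ΣK×+term0 (G a)) k)

  ΣK-δ : ∀ {F} a → (∀ x → x ≢ a → F x ≈ zeroζ) → ΣK F ≈ F a
  ΣK-δ a F≈0 = ≈Σ.sumOver-δ elements unique (complete a) (λ {x} _ → F≈0 x)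

  ΣK-const : ∀ m → ΣK (λ _ → fromℕ m) ≐ fromℕ (order ℕ.* m)
  ΣK-const m = sumOver-fromℕ m elements

  -- Translating by an element t with Tr t = 1 multiplies ΣK ψ by ζ, so all its
  -- coefficients agree.
  Σψ≈0 : ΣK ψ ≈ zeroζ
  Σψ≈0 = rotation-invariant⇒≈0 (trIndex t) (trans (ιFin-trIndex t) Trt≡1) λ k → begin
    ΣK ψ (k ⊕ (⊖ trIndex t))      ≡⟨ ζ^-*-shift (trIndex t) (ΣK ψ) k ⟨
    (ψ t *ζ ΣK ψ) k               ≡⟨ *ζ-distribˡ-sumOver (ψ t) ψ elements k ⟩
    ΣK (λ x → ψ t *ζ ψ x) k       ≡⟨ ζΣ.sumOver-cong elements (λ {x} _ → ψ-+ t x) k ⟩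
    ΣK (ψ ∘ (t +_)) k             ≡⟨ ΣK-reindex ψ (t +_) (_- t) t+x-t≡x t+[y-t]≡y k ⟩
    ΣK ψ k                        ∎
    where
    t : Carrier
    t = proj₁ ∃Tr≡1
    Trt≡1 : Tr t ≡ 1#
    Trt≡1 = proj₂ ∃Tr≡1
    t+x-t≡x : ∀ x → t + x - t ≡ x
    t+x-t≡x x = solve 2 (λ t x → t :+ x :- t := x) refl t x
    t+[y-t]≡y : ∀ y → t + (y - t) ≡ y
    t+[y-t]≡y y = solve 2 (λ t y → t :+ (y :- t) := y) refl t y

  Σψ-affine≈0 : ∀ a {c} → c ≢ 0# → ΣK (λ x → ψ (a + c * x)) ≈ zeroζ
  Σψ-affine≈0 a {c} c≢0 = ≈-trans {ΣK (λ x → ψ (a + c * x))} {ΣK ψ} {zeroζ}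
    (≐⇒≈ (ΣK-reindex ψ (λ x → a + c * x) (λ y → c ⁻¹ * (y - a)) c⁻¹[a+cx-a]≡x a+c[c⁻¹[y-a]]≡y)) Σψ≈0
    where
    c⁻¹[a+cx-a]≡x : ∀ x → c ⁻¹ * ((a + c * x) - a) ≡ x
    c⁻¹[a+cx-a]≡x x = trans (cong (c ⁻¹ *_) (solve 3 (λ a c x → (a :+ c :* x) :- a := c :* x) refl a c x))
                            (x⁻¹*[x*y]≡y c≢0 x)
    a+c[c⁻¹[y-a]]≡y : ∀ y → a + c * (c ⁻¹ * (y - a)) ≡ y
    a+c[c⁻¹[y-a]]≡y y = trans (cong (a +_) (x*[x⁻¹*y]≡y c≢0 (y - a)))
                              (solve 2 (λ a y → a :+ (y :- a) := y) refl a y)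

module WeilSum (K : FiniteField) {p} .{{_ : NonZero p}} (p-prime : Prime p)
               (char-p : FiniteField.ι K p ≡ FiniteField.0# K)
               (n : ℕ) (order≡p^n : FiniteField.order K ≡ p ℕ.^ n)
               {s} (s≥1 : s ℕ.≥ 1) (coprime : gcd s (FiniteField.order K ∸ 1) ≡ 1) where
  open AdditiveCharacter K p-prime char-p n order≡p^n public
  open Weil K p n s public using (W; ∣_∣; bar; _·_; _[1]; _≈GA_)

  private
    root : Carrier → Carrier
    root = proj₁ (s-th-root s≥1 coprime)
    root-^ : ∀ x → root (x ^ s) ≡ x
    root-^ = proj₁ (proj₂ (s-th-root s≥1 coprime))
    ^-root : ∀ y → root y ^ s ≡ y
    ^-root = proj₂ (proj₂ (s-th-root s≥1 coprime))

  ΣK-^s : ∀ (F : Carrier → ℤζ) → ΣK (λ x → F (x ^ s)) ≐ ΣK F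
  ΣK-^s F = ΣK-reindex F (_^ s) root root-^ ^-root

  ^s-injective : ∀ {x y} → x ^ s ≡ y ^ s → x ≡ y
  ^s-injective {x} {y} x^s≡y^s = trans (sym (root-^ x)) (trans (cong root x^s≡y^s) (root-^ y))

  Σψ[x^s+b]≈0 : ∀ b → ΣK (λ x → ψ (x ^ s + b)) ≈ zeroζ
  Σψ[x^s+b]≈0 b = begin
    ΣK (λ x → ψ (x ^ s + b))   ≈⟨ ≐⇒≈ (ΣK-^s (λ z → ψ (z + b))) ⟩
    ΣK (λ z → ψ (z + b))       ≈⟨ ≐⇒≈ (ζΣ.sumOver-cong elements λ {z} _ k → cong (λ x → ψ x k) (z+b≡b+1*z z)) ⟩
    ΣK (λ z → ψ (b + 1# * z))  ≈⟨ Σψ-affine≈0 b 1≢0 ⟩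
    zeroζ                      ∎
    where
    open ≈-Reasoning
    z+b≡b+1*z : ∀ z → z + b ≡ b + 1# * z
    z+b≡b+1*z z = trans (+-comm z b) (cong (b +_) (sym (*-identityˡ z)))

  ψW : Carrier → Carrier → ℤζ
  ψW u x = ψ (x ^ s - u * x)

  ΣK-ψW≈0 : ∀ x → x ≢ 0# → ΣK (λ u → ψW u x) ≈ zeroζ
  ΣK-ψW≈0 x x≢0 = begin
    ΣK (λ u → ψW u x)                  ≈⟨ ≐⇒≈ (ζΣ.sumOver-cong elements λ {u} _ k → cong (flip ψ k) (xs-ux u)) ⟩
    ΣK (λ u → ψ (x ^ s + (- x) * u))   ≈⟨ Σψ-affine≈0 (x ^ s) (x≢0 ∘ -x≡0⇒x≡0) ⟩
    zeroζ                              ∎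
    where
    open ≈-Reasoning
    xs-ux : ∀ u → x ^ s - u * x ≡ x ^ s + (- x) * u
    xs-ux u = solve 3 (λ X u x → X :- u :* x := X :+ (:- x) :* u) refl (x ^ s) u x

  ΣK-ψW-0 : ΣK (λ u → ψW u 0#) ≐ fromℕ order
  ΣK-ψW-0 k = begin
    ΣK (λ u → ψW u 0#) k         ≡⟨ ζΣ.sumOver-cong elements (λ {u} _ → ψW-0 u) k ⟩
    ΣK (λ _ → fromℕ 1) k         ≡⟨ ΣK-const 1 k ⟩
    fromℕ (order ℕ.* 1) k        ≡⟨ cong (λ m → fromℕ m k) (ℕ.*-identityʳ order) ⟩
    fromℕ order k                ∎
    where
    open ≡-Reasoning
    ψW-0 : ∀ u → ψW u 0# ≐ fromℕ 1
    ψW-0 u k = trans (cong (λ y → ψ y k) (trans (cong₂ _-_ (0^n≡0 s≥1) (zeroʳ u)) (-‿inverseʳ 0#))) (ψ-0 k)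

  ΣK-ψW0≈0 : ΣK (ψW 0#) ≈ zeroζ
  ΣK-ψW0≈0 = ≈-trans {ΣK (ψW 0#)} {ΣK (λ x → ψ (x ^ s + 0#))} {zeroζ}
    (≐⇒≈ (ζΣ.sumOver-cong elements λ {x} _ k → cong (λ y → ψ (x ^ s + y) k) (trans (cong -_ (zeroˡ x)) -0#≈0#)))
    (Σψ[x^s+b]≈0 0#)

  -- Summing over all u instead of u ≠ 0 adds ΣK (ψW 0#), which vanishes.
  |W|≈q : ∣ W ∣ ≈ fromℕ order
  |W|≈q = begin
    ΣK× (λ u → ΣK (ψW u))              ≈⟨ ≐⇒≈ (ζΣ.sumOver-swap ψW units elements) ⟩
    ΣK (λ x → ΣK× (λ u → ψW u x))      ≈⟨ ≈0-cancelʳ _ (fromℕ order) ΣK-ψW0≈0 ΣKΣK×+ΣK≈q ⟩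
    fromℕ order                        ∎
    where
    open ≈-Reasoning
    ΣKΣK×+ΣK≈q : (ΣK (λ x → ΣK× (λ u → ψW u x)) +ζ ΣK (ψW 0#)) ≈ fromℕ order
    ΣKΣK×+ΣK≈q = begin
      ΣK (λ x → ΣK× (λ u → ψW u x)) +ζ ΣK (ψW 0#)  ≈⟨ ≐⇒≈ (sumOver-ΣK×+term0 (λ x u → ψW u x) elements) ⟩
      ΣK (λ x → ΣK (λ u → ψW u x))                 ≈⟨ ΣK-δ 0# ΣK-ψW≈0 ⟩
      ΣK (λ u → ψW u 0#)                           ≈⟨ ≐⇒≈ ΣK-ψW-0 ⟩
      fromℕ order                                  ∎

  -- The summand of (W · bar W) w after expanding W u and its conjugate, with x and y
  -- their summation variables.
  ψWW : Carrier → Carrier → Carrier → Carrier → ℤζ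
  ψWW w u x y = ψ ((x ^ s - y ^ s) + u * (w ⁻¹ * y - x))

  diagonal : Carrier → ℤζ
  diagonal w = ΣK (λ y → ΣK (λ _ → ψ ((w ⁻¹ * y) ^ s - y ^ s)))

  W*conjW≐ : ∀ {w u} → w ≢ 0# → u ≢ 0# → (W u *ζ conj (W ((u ⁻¹ * w) ⁻¹))) ≐ ΣK (λ x → ΣK (ψWW w u x))
  W*conjW≐ {w} {u} w≢0 u≢0 = begin
    W u *ζ conj (ΣK (ψW v))
      ≈⟨ *ζ-congʳ (W u) {b′ = ΣK (conj ∘ ψW v)} (conj-sumOver (ψW v) elements) ⟩
    ΣK (ψW u) *ζ ΣK (conj ∘ ψW v)
      ≈⟨ *ζ-distribʳ-sumOver (ψW u) elements (ΣK (conj ∘ ψW v)) ⟩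
    ΣK (λ x → ψW u x *ζ ΣK (conj ∘ ψW v))
      ≈⟨ ζΣ.sumOver-cong elements (λ {x} _ → *ζ-distribˡ-sumOver (ψW u x) (conj ∘ ψW v) elements) ⟩
    ΣK (λ x → ΣK (λ y → ψW u x *ζ conj (ψW v y)))
      ≈⟨ ζΣ.sumOver-cong elements (λ {x} _ → ζΣ.sumOver-cong elements λ {y} _ → term x y) ⟩
    ΣK (λ x → ΣK (ψWW w u x)) ∎
    where
    open ≐-Reasoning
    v : Carrier
    v = (u ⁻¹ * w) ⁻¹
    v≡uw⁻¹ : v ≡ u * w ⁻¹
    v≡uw⁻¹ = trans (⁻¹-distrib-* (⁻¹-≢0 u≢0) w≢0) (cong (_* w ⁻¹) (⁻¹-involutive u≢0))
    exponent : ∀ x y → (x ^ s - u * x) + - (y ^ s - v * y) ≡ (x ^ s - y ^ s) + u * (w ⁻¹ * y - x)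
    exponent x y = trans (cong (λ z → (x ^ s - u * x) + - (y ^ s - z * y)) v≡uw⁻¹)
      (solve 6 (λ X Y u w′ x y → (X :- u :* x) :+ :- (Y :- (u :* w′) :* y) := (X :- Y) :+ u :* (w′ :* y :- x))
             refl (x ^ s) (y ^ s) u (w ⁻¹) x y)
    term : ∀ x y → (ψW u x *ζ conj (ψW v y)) ≐ ψWW w u x y
    term x y k = trans (*ζ-congʳ (ψW u x) {conj (ψW v y)} (conj-ψ (y ^ s - v * y)) k)
                       (trans (ψ-+ (x ^ s - u * x) (- (y ^ s - v * y)) k) (cong (λ z → ψ z k) (exponent x y)))

  W·W̄≐ : ∀ {w} → w ≢ 0# → (W · bar W) w ≐ ΣK (λ x → ΣK (λ y → ΣK× (λ u → ψWW w u x y)))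
  W·W̄≐ {w} w≢0 = begin
    ΣK× (λ u → W u *ζ conj (W ((u ⁻¹ * w) ⁻¹)))
      ≈⟨ ζΣ.sumOver-cong units (λ u∈ → W*conjW≐ w≢0 (units-≢0 u∈)) ⟩
    ΣK× (λ u → ΣK (λ x → ΣK (ψWW w u x)))
      ≈⟨ ζΣ.sumOver-swap (λ u x → ΣK (ψWW w u x)) units elements ⟩
    ΣK (λ x → ΣK× (λ u → ΣK (ψWW w u x)))
      ≈⟨ ζΣ.sumOver-cong elements (λ {x} _ → ζΣ.sumOver-swap (λ u → ψWW w u x) units elements) ⟩
    ΣK (λ x → ΣK (λ y → ΣK× (λ u → ψWW w u x y))) ∎
    where open ≐-Reasoning

  ΣΣψWW-0≈0 : ∀ w → ΣK (λ x → ΣK (ψWW w 0# x)) ≈ zeroζ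
  ΣΣψWW-0≈0 w = begin
    ΣK (λ x → ΣK (ψWW w 0# x))
      ≈⟨ ≐⇒≈ (ζΣ.sumOver-cong elements λ {x} _ → ζΣ.sumOver-cong elements λ {y} _ → u≡0 x y) ⟩
    ΣK (λ x → ΣK (λ y → ψ (x ^ s - y ^ s)))
      ≈⟨ ≐⇒≈ (ζΣ.sumOver-swap (λ x y → ψ (x ^ s - y ^ s)) elements elements) ⟩
    ΣK (λ y → ΣK (λ x → ψ (x ^ s - y ^ s)))
      ≈⟨ ≈Σ.sumOver-ε elements (λ {y} _ → Σψ[x^s+b]≈0 (- (y ^ s))) ⟩
    zeroζ ∎
    where
    open ≈-Reasoning
    u≡0 : ∀ x y → ψWW w 0# x y ≐ ψ (x ^ s - y ^ s)
    u≡0 x y k = cong (λ z → ψ z k) (trans (cong (x ^ s - y ^ s +_) (zeroˡ _)) (+-identityʳ _))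

  ΣK-ψWW≈0 : ∀ w y x → x ≢ w ⁻¹ * y → ΣK (λ u → ψWW w u x y) ≈ zeroζ
  ΣK-ψWW≈0 w y x x≢w⁻¹y = begin
    ΣK (λ u → ψWW w u x y)
      ≈⟨ ≐⇒≈ (ζΣ.sumOver-cong elements λ {u} _ k → cong (λ z → ψ (x ^ s - y ^ s + z) k) (*-comm u (w ⁻¹ * y - x))) ⟩
    ΣK (λ u → ψ ((x ^ s - y ^ s) + (w ⁻¹ * y - x) * u))
      ≈⟨ Σψ-affine≈0 (x ^ s - y ^ s) (λ d≡0 → x≢w⁻¹y (sym (x-y≡0⇒x≡y d≡0))) ⟩
    zeroζ ∎
    where open ≈-Reasoning

  ΣK-ψWW-diagonal : ∀ w y → ΣK (λ u → ψWW w u (w ⁻¹ * y) y) ≐ ΣK (λ _ → ψ ((w ⁻¹ * y) ^ s - y ^ s))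
  ΣK-ψWW-diagonal w y = ζΣ.sumOver-cong elements λ {u} _ k → cong (λ z → ψ z k) (begin
    A + u * (w ⁻¹ * y - w ⁻¹ * y)   ≡⟨ cong (λ z → A + u * z) (-‿inverseʳ (w ⁻¹ * y)) ⟩
    A + u * 0#                      ≡⟨ cong (A +_) (zeroʳ u) ⟩
    A + 0#                          ≡⟨ +-identityʳ A ⟩
    A                               ∎)
    where
    open ≡-Reasoning
    A : Carrier
    A = (w ⁻¹ * y) ^ s - y ^ s

  ΣΣΣψWW≈diagonal : ∀ w → ΣK (λ x → ΣK (λ y → ΣK (λ u → ψWW w u x y))) ≈ diagonal w
  ΣΣΣψWW≈diagonal w = begin
    ΣK (λ x → ΣK (λ y → ΣK (λ u → ψWW w u x y)))
      ≈⟨ ≐⇒≈ (ζΣ.sumOver-swap (λ x y → ΣK (λ u → ψWW w u x y)) elements elements) ⟩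
    ΣK (λ y → ΣK (λ x → ΣK (λ u → ψWW w u x y)))
      ≈⟨ ≈Σ.sumOver-cong elements (λ {y} _ → ΣK-δ (w ⁻¹ * y) (ΣK-ψWW≈0 w y)) ⟩
    ΣK (λ y → ΣK (λ u → ψWW w u (w ⁻¹ * y) y))
      ≈⟨ ≐⇒≈ (ζΣ.sumOver-cong elements λ {y} _ → ΣK-ψWW-diagonal w y) ⟩
    diagonal w ∎
    where open ≈-Reasoning

  -- As for |W|, summing over all u adds the vanishing u = 0 terms; then the sum over u
  -- forces x = w⁻¹ y.
  W·W̄≈diagonal : ∀ {w} → w ≢ 0# → (W · bar W) w ≈ diagonal w
  W·W̄≈diagonal {w} w≢0 = begin
    (W · bar W) w                                  ≈⟨ ≐⇒≈ (W·W̄≐ w≢0) ⟩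
    ΣK (λ x → ΣK (λ y → ΣK× (λ u → H u x y)))      ≈⟨ ≈0-cancelʳ _ (diagonal w) (ΣΣψWW-0≈0 w) ΣΣΣK×+ΣΣ≈diagonal ⟩
    diagonal w                                     ∎
    where
    open ≈-Reasoning
    H : Carrier → Carrier → Carrier → ℤζ
    H = ψWW w
    ΣΣΣK×+ΣΣ≈diagonal : (ΣK (λ x → ΣK (λ y → ΣK× (λ u → H u x y))) +ζ ΣK (λ x → ΣK (H 0# x))) ≈ diagonal w
    ΣΣΣK×+ΣΣ≈diagonal = begin
      ΣK (λ x → ΣK (λ y → ΣK× (λ u → H u x y))) +ζ ΣK (λ x → ΣK (H 0# x))
        ≈⟨ ≐⇒≈ (ζΣ.sumOver-∙ (λ x → ΣK (λ y → ΣK× (λ u → H u x y))) (λ x → ΣK (H 0# x)) elements) ⟨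
      ΣK (λ x → ΣK (λ y → ΣK× (λ u → H u x y)) +ζ ΣK (H 0# x))
        ≈⟨ ≐⇒≈ (ζΣ.sumOver-cong elements λ {x} _ → sumOver-ΣK×+term0 (λ y u → H u x y) elements) ⟩
      ΣK (λ x → ΣK (λ y → ΣK (λ u → H u x y)))
        ≈⟨ ΣΣΣψWW≈diagonal w ⟩
      diagonal w ∎

  diagonal-1 : diagonal 1# ≐ fromℕ (order ℕ.* order)
  diagonal-1 k = begin
    diagonal 1# k
      ≡⟨ ζΣ.sumOver-cong elements (λ {y} _ → ζΣ.sumOver-cong elements λ _ k →
                                               trans (cong (λ z → ψ z k) (exponent≡0 y)) (ψ-0 k)) k ⟩
    ΣK (λ _ → ΣK (λ _ → fromℕ 1)) k
      ≡⟨ ζΣ.sumOver-cong elements (λ _ k → trans (ΣK-const 1 k) (cong (flip fromℕ k) (ℕ.*-identityʳ order))) k ⟩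
    ΣK (λ _ → fromℕ order) k
      ≡⟨ ΣK-const order k ⟩
    fromℕ (order ℕ.* order) k ∎
    where
    open ≡-Reasoning
    exponent≡0 : ∀ y → (1# ⁻¹ * y) ^ s - y ^ s ≡ 0#
    exponent≡0 y = trans (cong (λ z → (z * y) ^ s - y ^ s) 1⁻¹≡1)
                         (trans (cong (λ z → z ^ s - y ^ s) (*-identityˡ y)) (-‿inverseʳ _))

  [ay]^s-y^s≡0+[a^s-1]y^s : ∀ a y → (a * y) ^ s - y ^ s ≡ 0# + (a ^ s - 1#) * y ^ s
  [ay]^s-y^s≡0+[a^s-1]y^s a y = begin
    (a * y) ^ s - y ^ s         ≡⟨ cong₂ _-_ (^-distribʳ-* a y s) (sym (*-identityˡ (y ^ s))) ⟩
    a ^ s * y ^ s - 1# * y ^ s  ≡⟨ solve 3 (λ a Y o → a :* Y :- o :* Y := (a :- o) :* Y) refl (a ^ s) (y ^ s) 1# ⟩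
    (a ^ s - 1#) * y ^ s        ≡⟨ +-identityˡ _ ⟨
    0# + (a ^ s - 1#) * y ^ s   ∎
    where open ≡-Reasoning

  -- For w ≠ 1 the inner sum is Σ ψ (c y ^ s) with c = w⁻¹ ^ s - 1, and c ≠ 0 because
  -- the s-th power map is injective.
  diagonal-≢1 : ∀ {w} → w ≢ 0# → w ≢ 1# → diagonal w ≈ zeroζ
  diagonal-≢1 {w} w≢0 w≢1 = begin
    diagonal w
      ≈⟨ ≐⇒≈ (ζΣ.sumOver-swap (λ y _ → ψ ((w ⁻¹ * y) ^ s - y ^ s)) elements elements) ⟩
    ΣK (λ _ → ΣK (λ y → ψ ((w ⁻¹ * y) ^ s - y ^ s)))
      ≈⟨ ≈Σ.sumOver-ε elements (λ _ → inner≈0) ⟩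
    zeroζ ∎
    where
    open ≈-Reasoning
    c : Carrier
    c = (w ⁻¹) ^ s - 1#
    c≢0 : c ≢ 0#
    c≢0 c≡0 = w≢1 (trans (sym (⁻¹-involutive w≢0)) (trans (cong _⁻¹ w⁻¹≡1) 1⁻¹≡1))
      where
      w⁻¹≡1 : w ⁻¹ ≡ 1#
      w⁻¹≡1 = ^s-injective (trans (x-y≡0⇒x≡y c≡0) (sym (1^n≡1 s)))
    inner≈0 : ΣK (λ y → ψ ((w ⁻¹ * y) ^ s - y ^ s)) ≈ zeroζ
    inner≈0 = begin
      ΣK (λ y → ψ ((w ⁻¹ * y) ^ s - y ^ s))
        ≈⟨ ≐⇒≈ (ζΣ.sumOver-cong elements λ {y} _ k → cong (λ z → ψ z k) ([ay]^s-y^s≡0+[a^s-1]y^s (w ⁻¹) y)) ⟩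
      ΣK (λ y → ψ (0# + c * y ^ s))  ≈⟨ ≐⇒≈ (ΣK-^s (λ z → ψ (0# + c * z))) ⟩
      ΣK (λ z → ψ (0# + c * z))      ≈⟨ Σψ-affine≈0 0# c≢0 ⟩
      zeroζ                          ∎

  W·W̄≈q²[1] : (W · bar W) ≈GA (fromℕ (order ℕ.* order) [1])
  W·W̄≈q²[1] w w≢0 with w ≟ 1#
  ... | yes refl = ≈-trans {(W · bar W) 1#} {diagonal 1#} {fromℕ (order ℕ.* order)}
                           (W·W̄≈diagonal w≢0) (≐⇒≈ diagonal-1)
  ... | no  w≢1  = ≈-trans {(W · bar W) w} {diagonal w} {zeroζ} (W·W̄≈diagonal w≢0) (diagonal-≢1 w≢0 w≢1)

open import Data.Nat using (_^_; _*_; _≥_)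

lemma5p8 : (K : FiniteField) (p : ℕ) .{{_ : NonZero p}} → Prime p
    → FiniteField.ι K p ≡ FiniteField.0# K
    → (n : ℕ) → FiniteField.order K ≡ p ^ n
    → (s : ℕ) → s ≥ 1 → gcd s (FiniteField.order K ∸ 1) ≡ 1
    → let open Weil K p n s
          open Cyclotomic p
          q = FiniteField.order K
      in (∣ W ∣ ≈ fromℕ q) × ((W · bar W) ≈GA (fromℕ (q * q) [1]))
lemma5p8 K p p-prime char-p n order≡p^n s s≥1 coprime = |W|≈q , W·W̄≈q²[1]
  where open WeilSum K p-prime char-p n order≡p^n s≥1 coprime
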